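{- Let $m\geq 3$ be an integer and $\mathbb{F}_{2^m}^*=\mathbb{F}_{2^m}\setminus\{0\}$. For $3\leq k\leq 2^m-4$ let $W_k=\{B\subseteq \mathbb{F}_{2^m}^* : |B|=k,\ \sum_{x\in B}x=0\}$ and let $\lambda_k$ be the number of blocks of $W_k$ containing any given pair of distinct elements of $\mathbb{F}_{2^m}^*$ (a well-defined constant). Set $\lambda_{2^m-3}:=0$. Then for $3\leq k\leq 2^m-4$, $$\lambda_{k+1}=\begin{cases} \frac{2^m-k-1}{k-1}\lambda_k, & k\equiv 1,3\pmod 4,\\ \frac{2^m-k-1}{k-1}\lambda_k+\binom{2^{m-1}-2}{k/2-1}, & k\equiv 2\pmod 4,\\ \frac{2^m-k-1}{k-1}\lambda_k-\binom{2^{m-1}-2}{k/2-1}, & k\equiv 0\pmod 4;\end{cases}$$ equivalently, $$\lambda_{k+1}=\frac{2^m-k-1}{k-1}\lambda_k-\cos\frac{k\pi}{2}\binom{2^{m-1}-2}{\lfloor k/2-1\rfloor}.$$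
   Context: $\mathbb{F}_{2^m}$ denotes the finite field with $2^m$ elements. -}

module Defs where

open import Data.Bool using (Bool; true; false; _xor_; not; if_then_else_; _∧_)
open import Data.Nat using (ℕ; zero; suc; _∸_; _^_; _≡ᵇ_)
open import Data.Vec using (Vec; []; _∷_; replicate)
open import Data.Vec.Properties using (≡-dec)
open import Data.List using (List; []; _∷_; _++_; map; filter; length; foldr)
open import Data.Bool.ListAction using (any)
open import Relation.Nullary using (Dec; yes; no; ¬_; does)
open import Relation.Binary.PropositionalEquality using (_≡_)
import Data.Bool as B

-- The additive group of F_{2^m}: F_2^m, i.e. bit vectors of length m under xor.
-- (Only the additive structure of F_{2^m} enters the definition of W_k.)
F : ℕ → Set
F m = Vec Bool m

_⊕_ : ∀ {m} → F m → F m → F m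
[] ⊕ [] = []
(a ∷ u) ⊕ (b ∷ v) = (a xor b) ∷ (u ⊕ v)

𝟎 : ∀ {m} → F m
𝟎 = replicate _ false

_≟F_ : ∀ {m} (x y : F m) → Dec (x ≡ y)
_≟F_ = ≡-dec B._≟_

allF : (m : ℕ) → List (F m)
allF zero = [] ∷ []
allF (suc m) = map (false ∷_) (allF m) ++ map (true ∷_) (allF m)

nonzeroF : (m : ℕ) → List (F m)
nonzeroF m = filter (λ x → Relation.Nullary.¬? (x ≟F 𝟎)) (allF m)

-- all sublists of a list; for a repetition-free list these are exactly its subsets
sublists : ∀ {A : Set} → List A → List (List A)
sublists [] = [] ∷ []
sublists (x ∷ xs) = sublists xs ++ map (x ∷_) (sublists xs)

sumF : ∀ {m} → List (F m) → F m
sumF = foldr _⊕_ 𝟎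

memb : ∀ {m} → F m → List (F m) → Bool
memb x = any (λ y → does (x ≟F y))

W : (m k : ℕ) → List (List (F m))
W m k = filter (λ B → (length B Data.Nat.≟ k) Relation.Nullary.×-dec (sumF B ≟F 𝟎))
               (sublists (nonzeroF m))

countPair : (m k : ℕ) → F m → F m → ℕ
countPair m k x y = length (filter (λ B → memb x B ∧ memb y B B.≟ true) (W m k))

lam : (m k : ℕ) → F m → F m → ℕ
lam m k x y = if k ≡ᵇ (2 ^ m ∸ 3) then 0 else countPair m k x y

-- By orthogonality of the characters χ_a(v) = (-1)^⟨a,v⟩ of F₂^m, 2^m λ_k is the sum over a of
-- χ_a(x) χ_a(y) [t^(k-2)] ∏ (1 + χ_a(z) t), the product over the nonzero z ≠ x, y.  For a ≠ 0 exactly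
-- half of F₂^m is orthogonal to a, so the product is (1+t)^p (1-t)^q with p, q fixed by (⟨a,x⟩, ⟨a,y⟩),
-- and this pair is equidistributed over F₂² as a ranges over F₂^m.  With r = 2^(m-1) - 3 this gives
--   2^m λ_(j+2) = C(2r+3, j) - [t^j] (1-t)³ (1-t²)^r + 2^m [t^(j-2)] (1-t) (1-t²)^r,
-- and [t^j] (1-t²)^r = cos(jπ/2) C(r, ⌊j/2⌋).  The recurrence is then a polynomial identity between
-- binomial coefficients, obtained for each parity of j from the absorption identity
-- (k+1) C(n,k+1) = (n-k) C(n,k).  The closed form vanishes at k = 2^m - 3, in accordance with λ_(2^m-3) := 0.

module Submission where

open import Defs
open import Algebra.Bundles using (CommutativeRing)
import Algebra.Properties.CommutativeSemigroup as CommutativeSemigroupProperties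
open import Data.Bool as Bool using (Bool; true; false; not; _∧_; _∨_; _xor_; if_then_else_)
open import Data.Bool.Properties
  using (∧-distribˡ-xor; xor-∧-commutativeRing; ∨-identityʳ; ∨-zeroʳ; ∧-comm; ∧-zeroʳ)
open import Data.Empty using (⊥-elim)
open import Data.Integer as ℤ using (ℤ; +_; -_; _*_; _+_; _-_; _⊖_; -1ℤ)
import Data.Integer.Properties as ℤₚ
open import Data.Integer.Tactic.RingSolver using (solve-∀)
open import Data.List using (List; []; _∷_; _++_; map; filter; filterᵇ; length; replicate)
import Data.List.Properties as Listₚ
open import Data.List.Membership.Propositional using (_∈_; _∉_)
open import Data.List.Membership.Propositional.Properties using (∈-filter⁻; ∈-map⁻)
open import Data.List.Relation.Unary.All using ([]; _∷_)
open import Data.List.Relation.Unary.All.Properties using (All¬⇒¬Any)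
open import Data.List.Relation.Unary.AllPairs using ([]; _∷_)
open import Data.List.Relation.Unary.Any using (here; there)
open import Data.List.Relation.Unary.Unique.Propositional using (Unique)
import Data.List.Relation.Unary.Unique.Propositional.Properties as Uniqueₚ
open import Data.Nat as ℕ using (ℕ; zero; suc; _≤_; _∸_; _^_; _%_; _/_; _≡ᵇ_; ⌊_/2⌋; s≤s; z≤n)
open import Data.Nat.Combinatorics using (_C_; nCk+nC[k+1]≡[n+1]C[k+1]; nC1≡n; nCn≡1; nCk≡nC[n∸k])
open import Data.Nat.DivMod using ([m+n]%n≡m%n; m*n/n≡m)
import Data.Nat.Properties as ℕₚ
open import Data.Nat.Tactic.RingSolver using () renaming (solve-∀ to ℕ-solve-∀)
open import Data.Product using (_×_; _,_; proj₂)
open import Data.Vec using ([]; _∷_)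
open import Data.Vec.Properties using (∷-injectiveʳ)
open import Function using (_∘_)
open import Level using (0ℓ)
open import Relation.Binary.PropositionalEquality
open import Relation.Nullary using (¬_; yes; no; does; ¬?)
open import Relation.Nullary.Decidable using (T?)
open import Relation.Unary using (Pred; Decidable)

open CommutativeSemigroupProperties (CommutativeRing.+-commutativeSemigroup xor-∧-commutativeRing)
  using () renaming (interchange to xor-interchange)

private
  variable
    A B : Set
    m : ℕ
    L : List (F m)

∑ : List A → (A → ℤ) → ℤ
∑ []       f = + 0
∑ (x ∷ xs) f = f x + ∑ xs f

infix 9 ∑
syntax ∑ xs (λ x → e) = ∑[ x ← xs ] e

⟦_⟧ : Bool → ℤ
⟦ true  ⟧ = + 1
⟦ false ⟧ = + 0

⟦∧⟧ : ∀ a b → ⟦ a ∧ b ⟧ ≡ ⟦ a ⟧ * ⟦ b ⟧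
⟦∧⟧ true  b = sym (ℤₚ.*-identityˡ ⟦ b ⟧)
⟦∧⟧ false b = refl

∑-++ : ∀ (xs ys : List A) f → ∑ (xs ++ ys) f ≡ ∑ xs f + ∑ ys f
∑-++ []       ys f = sym (ℤₚ.+-identityˡ _)
∑-++ (x ∷ xs) ys f = trans (cong (_+_ (f x)) (∑-++ xs ys f)) (sym (ℤₚ.+-assoc (f x) _ _))

∑-map : ∀ (g : A → B) xs f → ∑ (map g xs) f ≡ ∑ xs (f ∘ g)
∑-map g []       f = refl
∑-map g (x ∷ xs) f = cong (_+_ (f (g x))) (∑-map g xs f)

∑-cong : ∀ (xs : List A) {f g} → (∀ x → f x ≡ g x) → ∑ xs f ≡ ∑ xs g
∑-cong []       f≗g = refl
∑-cong (x ∷ xs) f≗g = cong₂ _+_ (f≗g x) (∑-cong xs f≗g)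

∑-+ : ∀ (xs : List A) f g → ∑[ x ← xs ] (f x + g x) ≡ ∑ xs f + ∑ xs g
∑-+ []       f g = refl
∑-+ (x ∷ xs) f g = trans (cong (_+_ (f x + g x)) (∑-+ xs f g)) (middle (f x) (g x) (∑ xs f) (∑ xs g))
  where
  middle : ∀ a b c d → a + b + (c + d) ≡ a + c + (b + d)
  middle = solve-∀

∑-*ˡ : ∀ (xs : List A) c f → ∑[ x ← xs ] (c * f x) ≡ c * ∑ xs f
∑-*ˡ []       c f = sym (ℤₚ.*-zeroʳ c)
∑-*ˡ (x ∷ xs) c f = trans (cong (_+_ (c * f x)) (∑-*ˡ xs c f)) (sym (ℤₚ.*-distribˡ-+ c (f x) _))

∑-const : ∀ (xs : List A) c → ∑[ _ ← xs ] c ≡ + length xs * c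
∑-const []       c = sym (ℤₚ.*-zeroˡ c)
∑-const (x ∷ xs) c = trans (cong (_+_ c) (∑-const xs c)) (suc-* c (+ length xs))
  where
  suc-* : ∀ c n → c + n * c ≡ (+ 1 + n) * c
  suc-* = solve-∀

∑-zero : ∀ (xs : List A) → ∑[ _ ← xs ] (+ 0) ≡ + 0
∑-zero []       = refl
∑-zero (x ∷ xs) = trans (ℤₚ.+-identityˡ _) (∑-zero xs)

∑-comm : ∀ (xs : List A) (ys : List B) (f : A → B → ℤ) → ∑[ x ← xs ] ∑[ y ← ys ] f x y ≡ ∑[ y ← ys ] ∑[ x ← xs ] f x y
∑-comm []       ys f = sym (∑-zero ys)
∑-comm (x ∷ xs) ys f = trans (cong (_+_ (∑ ys (f x))) (∑-comm xs ys f)) (sym (∑-+ ys (f x) _))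

∑-- : ∀ (xs : List A) f g → ∑[ x ← xs ] (f x - g x) ≡ ∑ xs f - ∑ xs g
∑-- []       f g = refl
∑-- (x ∷ xs) f g = trans (cong (_+_ (f x - g x)) (∑-- xs f g)) (shuffle (f x) (g x) (∑ xs f) (∑ xs g))
  where
  shuffle : ∀ a b c d → a - b + (c - d) ≡ a + c - (b + d)
  shuffle = solve-∀

∑-*ʳ : ∀ (xs : List A) f c → ∑ xs f * c ≡ ∑[ x ← xs ] (f x * c)
∑-*ʳ xs f c = trans (ℤₚ.*-comm (∑ xs f) c) (trans (sym (∑-*ˡ xs c f)) (∑-cong xs (λ x → ℤₚ.*-comm c (f x))))

∑-filter : ∀ {P : Pred A 0ℓ} (P? : Decidable P) xs g → ∑ (filter P? xs) g ≡ ∑[ x ← xs ] (⟦ does (P? x) ⟧ * g x)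
∑-filter P? []       g = refl
∑-filter P? (x ∷ xs) g with does (P? x)
... | true  = cong₂ _+_ (sym (ℤₚ.*-identityˡ (g x))) (∑-filter P? xs g)
... | false = trans (∑-filter P? xs g) (sym (ℤₚ.+-identityˡ _))

length-filter≡∑ : ∀ {P : Pred A 0ℓ} (P? : Decidable P) xs → + length (filter P? xs) ≡ ∑[ x ← xs ] ⟦ does (P? x) ⟧
length-filter≡∑ P? xs =
  trans (trans (sym (ℤₚ.*-identityʳ _)) (sym (∑-const (filter P? xs) (+ 1))))
        (trans (∑-filter P? xs (λ _ → + 1)) (∑-cong xs (λ x → ℤₚ.*-identityʳ _)))

sign : Bool → ℤ
sign false = + 1
sign true  = -1ℤ

sign-xor : ∀ a b → sign (a xor b) ≡ sign a * sign b
sign-xor false false = refl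
sign-xor false true  = refl
sign-xor true  false = refl
sign-xor true  true  = refl

dot : F m → F m → Bool
dot []      []      = false
dot (c ∷ a) (b ∷ v) = (c ∧ b) xor dot a v

χ : F m → F m → ℤ
χ a v = sign (dot a v)

dot-⊕ʳ : ∀ (a u v : F m) → dot a (u ⊕ v) ≡ dot a u xor dot a v
dot-⊕ʳ []      []      []      = refl
dot-⊕ʳ (c ∷ a) (p ∷ u) (q ∷ v) = begin
  (c ∧ (p xor q)) xor dot a (u ⊕ v)                ≡⟨ cong₂ _xor_ (∧-distribˡ-xor c p q) (dot-⊕ʳ a u v) ⟩
  ((c ∧ p) xor (c ∧ q)) xor (dot a u xor dot a v)  ≡⟨ xor-interchange (c ∧ p) (c ∧ q) (dot a u) (dot a v) ⟩
  ((c ∧ p) xor dot a u) xor ((c ∧ q) xor dot a v)  ∎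
  where open ≡-Reasoning

χ-⊕ʳ : ∀ (a u v : F m) → χ a (u ⊕ v) ≡ χ a u * χ a v
χ-⊕ʳ a u v = trans (cong sign (dot-⊕ʳ a u v)) (sign-xor (dot a u) (dot a v))

dot-𝟎ʳ : ∀ (a : F m) → dot a 𝟎 ≡ false
dot-𝟎ʳ []      = refl
dot-𝟎ʳ (c ∷ a) = trans (cong (_xor dot a 𝟎) (∧-zeroʳ c)) (dot-𝟎ʳ a)

dot-𝟎ˡ : ∀ (v : F m) → dot 𝟎 v ≡ false
dot-𝟎ˡ []      = refl
dot-𝟎ˡ (b ∷ v) = dot-𝟎ˡ v

dot-comm : ∀ (a v : F m) → dot a v ≡ dot v a
dot-comm []      []      = refl
dot-comm (c ∷ a) (b ∷ v) = cong₂ _xor_ (∧-comm c b) (dot-comm a v)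

length-allF : ∀ m → length (allF m) ≡ 2 ^ m
length-allF zero    = refl
length-allF (suc m) = begin
  length (map (false ∷_) (allF m) ++ map (true ∷_) (allF m))  ≡⟨ Listₚ.length-++ (map (false ∷_) (allF m)) ⟩
  length (map (false ∷_) (allF m)) ℕ.+ length (map (true ∷_) (allF m))
    ≡⟨ cong₂ ℕ._+_ (Listₚ.length-map (false ∷_) (allF m)) (Listₚ.length-map (true ∷_) (allF m)) ⟩
  length (allF m) ℕ.+ length (allF m)  ≡⟨ cong (λ n → n ℕ.+ n) (length-allF m) ⟩
  2 ^ m ℕ.+ 2 ^ m                      ≡⟨ cong (2 ^ m ℕ.+_) (sym (ℕₚ.+-identityʳ (2 ^ m))) ⟩
  2 ^ suc m                            ∎
  where open ≡-Reasoning

∑-allF-suc : ∀ m (f : F (suc m) → ℤ) → ∑ (allF (suc m)) f ≡ ∑[ a ← allF m ] f (false ∷ a) + ∑[ a ← allF m ] f (true ∷ a)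
∑-allF-suc m f = trans (∑-++ (map (false ∷_) (allF m)) _ f) (cong₂ _+_ (∑-map _ (allF m) f) (∑-map _ (allF m) f))

∑-χ-≢𝟎 : ∀ m (v : F m) → v ≢ 𝟎 → ∑[ a ← allF m ] χ a v ≡ + 0
∑-χ-≢𝟎 zero    []          v≢𝟎 = ⊥-elim (v≢𝟎 refl)
∑-χ-≢𝟎 (suc m) (true ∷ v)  v≢𝟎 = begin
  ∑[ a ← allF (suc m) ] χ a (true ∷ v)                 ≡⟨ ∑-allF-suc m (λ a → χ a (true ∷ v)) ⟩
  S + ∑[ a ← allF m ] sign (true xor dot a v)          ≡⟨ cong (_+_ S) (∑-cong (allF m) (λ a → sign-xor true (dot a v))) ⟩
  S + ∑[ a ← allF m ] (-1ℤ * χ a v)                    ≡⟨ cong (_+_ S) (∑-*ˡ (allF m) -1ℤ (λ a → χ a v)) ⟩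
  S + -1ℤ * S                                           ≡⟨ cancel S ⟩
  + 0                                                   ∎
  where
  open ≡-Reasoning
  S = ∑[ a ← allF m ] χ a v
  cancel : ∀ s → s + -1ℤ * s ≡ + 0
  cancel = solve-∀
∑-χ-≢𝟎 (suc m) (false ∷ v) v≢𝟎 =
  trans (∑-allF-suc m (λ a → χ a (false ∷ v))) (cong₂ _+_ (∑-χ-≢𝟎 m v v≢𝟎′) (∑-χ-≢𝟎 m v v≢𝟎′))
  where
  v≢𝟎′ : v ≢ 𝟎
  v≢𝟎′ v≡𝟎 = v≢𝟎 (cong (false ∷_) v≡𝟎)

∑-χ : ∀ m (v : F m) → ∑[ a ← allF m ] χ a v ≡ + (2 ^ m) * ⟦ does (v ≟F 𝟎) ⟧
∑-χ m v with v ≟F 𝟎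
... | yes refl = begin
  ∑[ a ← allF m ] χ a 𝟎      ≡⟨ ∑-cong (allF m) (λ a → cong sign (dot-𝟎ʳ a)) ⟩
  ∑[ _ ← allF m ] (+ 1)      ≡⟨ ∑-const (allF m) (+ 1) ⟩
  + length (allF m) * + 1    ≡⟨ cong (λ n → + n * + 1) (length-allF m) ⟩
  + (2 ^ m) * + 1            ∎
  where open ≡-Reasoning
... | no v≢𝟎 = trans (∑-χ-≢𝟎 m v v≢𝟎) (sym (ℤₚ.*-zeroʳ (+ (2 ^ m))))

∑-⟦≟𝟎⟧ : ∀ m → ∑[ a ← allF m ] ⟦ does (a ≟F 𝟎) ⟧ ≡ + 1
∑-⟦≟𝟎⟧ zero    = refl
∑-⟦≟𝟎⟧ (suc m) = trans (∑-allF-suc m (λ a → ⟦ does (a ≟F 𝟎) ⟧)) (cong₂ _+_ (∑-⟦≟𝟎⟧ m) (∑-zero (allF m)))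

count : Bool → List Bool → ℕ
count b []       = 0
count b (s ∷ ss) = if does (s Bool.≟ b) then suc (count b ss) else count b ss

count-false+true : ∀ bs → count false bs ℕ.+ count true bs ≡ length bs
count-false+true []           = refl
count-false+true (false ∷ bs) = cong suc (count-false+true bs)
count-false+true (true ∷ bs)  = trans (ℕₚ.+-suc (count false bs) _) (cong suc (count-false+true bs))

∑-sign : ∀ bs → ∑ bs sign ≡ + count false bs - + count true bs
∑-sign []           = refl
∑-sign (false ∷ bs) = trans (cong (_+_ (+ 1)) (∑-sign bs)) (shuffle (+ count false bs) (+ count true bs))
  where
  shuffle : ∀ f t → + 1 + (f - t) ≡ + 1 + f - t
  shuffle = solve-∀
∑-sign (true ∷ bs)  = trans (cong (_+_ -1ℤ) (∑-sign bs)) (shuffle (+ count false bs) (+ count true bs))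
  where
  shuffle : ∀ f t → -1ℤ + (f - t) ≡ f - (+ 1 + t)
  shuffle = solve-∀

count-dot-≢𝟎 : ∀ m b (a : F (suc m)) → a ≢ 𝟎 → count b (map (dot a) (allF (suc m))) ≡ 2 ^ m
count-dot-≢𝟎 m b a a≢𝟎 = case-b b
  where
  bs = map (dot a) (allF (suc m))
  balanced : + count false bs - + count true bs ≡ + 0
  balanced = begin
    + count false bs - + count true bs  ≡⟨ sym (∑-sign bs) ⟩
    ∑ bs sign                           ≡⟨ ∑-map (dot a) (allF (suc m)) sign ⟩
    ∑[ v ← allF (suc m) ] χ a v         ≡⟨ ∑-cong (allF (suc m)) (λ v → cong sign (dot-comm a v)) ⟩
    ∑[ v ← allF (suc m) ] χ v a         ≡⟨ ∑-χ-≢𝟎 (suc m) a a≢𝟎 ⟩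
    + 0                                 ∎
    where open ≡-Reasoning
  false≡true : count false bs ≡ count true bs
  false≡true = ℤₚ.+-injective (ℤₚ.i-j≡0⇒i≡j _ _ balanced)
  false+true : count false bs ℕ.+ count true bs ≡ 2 ^ suc m
  false+true = trans (count-false+true bs) (trans (Listₚ.length-map (dot a) (allF (suc m))) (length-allF (suc m)))
  twice-false : 2 ℕ.* count false bs ≡ 2 ℕ.* 2 ^ m
  twice-false = trans (cong (count false bs ℕ.+_) (trans (ℕₚ.+-identityʳ _) false≡true)) false+true
  case-b : ∀ b → count b bs ≡ 2 ^ m
  case-b false = ℕₚ.*-cancelˡ-≡ _ _ 2 twice-false
  case-b true  = trans (sym false≡true) (case-b false)

-- Formal power series in t, as coefficient sequences; shift multiplies by t.
Series : Set
Series = ℕ → ℤ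

one : Series
one zero    = + 1
one (suc _) = + 0

shift : Series → Series
shift f zero    = + 0
shift f (suc j) = f j

mul[1+ct] : ℤ → Series → Series
mul[1+ct] c f j = f j + c * shift f j

signProduct : List Bool → Series
signProduct []       = one
signProduct (b ∷ bs) = mul[1+ct] (sign b) (signProduct bs)

powSeries : ℕ → ℕ → Series
powSeries p q = signProduct (replicate p false ++ replicate q true)

shift-cong : ∀ {f g} → (∀ j → f j ≡ g j) → ∀ j → shift f j ≡ shift g j
shift-cong f≗g zero    = refl
shift-cong f≗g (suc j) = f≗g j

mul[1+ct]-cong : ∀ c {f g} → (∀ j → f j ≡ g j) → ∀ j → mul[1+ct] c f j ≡ mul[1+ct] c g j
mul[1+ct]-cong c f≗g j = cong₂ _+_ (f≗g j) (cong (c *_) (shift-cong f≗g j))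

shift-* : ∀ c f j → shift (λ i → c * f i) j ≡ c * shift f j
shift-* c f zero    = sym (ℤₚ.*-zeroʳ c)
shift-* c f (suc j) = refl

mul[1+ct]-comm : ∀ c d f j → mul[1+ct] c (mul[1+ct] d f) j ≡ mul[1+ct] d (mul[1+ct] c f) j
mul[1+ct]-comm c d f zero    = swap (f 0) c d
  where
  swap : ∀ x c d → x + d * + 0 + c * + 0 ≡ x + c * + 0 + d * + 0
  swap = solve-∀
mul[1+ct]-comm c d f (suc j) = swap (f (suc j)) (f j) (shift f j) c d
  where
  swap : ∀ x y z c d → x + d * y + c * (y + d * z) ≡ x + c * y + d * (y + c * z)
  swap = solve-∀

powSeries-sucʳ : ∀ p q j → powSeries p (suc q) j ≡ mul[1+ct] -1ℤ (powSeries p q) j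
powSeries-sucʳ zero    q j = refl
powSeries-sucʳ (suc p) q j =
  trans (mul[1+ct]-cong (+ 1) (powSeries-sucʳ p q) j) (mul[1+ct]-comm (+ 1) -1ℤ (powSeries p q) j)

signProduct-count : ∀ bs j → signProduct bs j ≡ powSeries (count false bs) (count true bs) j
signProduct-count []           j = refl
signProduct-count (false ∷ bs) j = mul[1+ct]-cong (+ 1) (signProduct-count bs) j
signProduct-count (true ∷ bs)  j =
  trans (mul[1+ct]-cong -1ℤ (signProduct-count bs) j) (sym (powSeries-sucʳ (count false bs) (count true bs) j))

≟F-refl : ∀ (v : F m) → does (v ≟F v) ≡ true
≟F-refl v with v ≟F v
... | yes _   = refl
... | no v≢v = ⊥-elim (v≢v refl)

memb-∈ : ∀ {v : F m} {L} → v ∈ L → memb v L ≡ true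
memb-∈ {v = v} {_ ∷ L} (here refl) = cong (_∨ memb v L) (≟F-refl v)
memb-∈ {v = v} {z ∷ L} (there v∈L) = trans (cong (does (v ≟F z) ∨_) (memb-∈ v∈L)) (∨-zeroʳ _)

memb-∉ : ∀ {v : F m} {L} → v ∉ L → memb v L ≡ false
memb-∉ {L = []}    v∉L = refl
memb-∉ {v = v} {L = z ∷ L} v∉L with v ≟F z
... | yes refl = ⊥-elim (v∉L (here refl))
... | no _     = memb-∉ (v∉L ∘ there)

∨-rearrange : ∀ s d b → s ∨ (d ∨ b) ≡ (d ∨ s) ∨ b
∨-rearrange true  true  b = refl
∨-rearrange true  false b = refl
∨-rearrange false true  b = refl
∨-rearrange false false b = refl

-- The disjuncts are ordered so that keep computes as soon as x ≟F z and y ≟F z are decided.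
keep : (x y : F m) → Bool → Bool → F m → Bool
keep x y sx sy z = (not (does (x ≟F z)) ∨ sx) ∧ (not (does (y ≟F z)) ∨ sy)

nonzeroExcept : (x y : F m) → List (F m)
nonzeroExcept {m} x y = filterᵇ (keep x y false false) (nonzeroF m)

module PairBlocks {m} (a x y : F m) where

  -- The flag sx (sy) set means that x (y) is already in the block and is no longer required.
  blockSum : List (F m) → Bool → Bool → Series
  blockSum L sx sy j =
    ∑[ B ← sublists L ] (⟦ length B ≡ᵇ j ⟧ * ⟦ (sx ∨ memb x B) ∧ (sy ∨ memb y B) ⟧ * χ a (sumF B))

  blockSum-nil : ∀ sx sy j → blockSum [] sx sy j ≡ one j * ⟦ sx ∧ sy ⟧
  blockSum-nil sx sy zero    rewrite dot-𝟎ʳ a | ∨-identityʳ sx | ∨-identityʳ sy =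
    trans (ℤₚ.+-identityʳ _) (ℤₚ.*-identityʳ _)
  blockSum-nil sx sy (suc j) = refl

  blockSum-cons : ∀ z L sx sy j →
    blockSum (z ∷ L) sx sy j ≡ blockSum L sx sy j + shift (blockSum L (does (x ≟F z) ∨ sx) (does (y ≟F z) ∨ sy)) j * χ a z
  blockSum-cons z L sx sy j =
    trans (∑-++ (sublists L) (map (z ∷_) (sublists L)) _)
          (cong (_+_ (blockSum L sx sy j)) (trans (∑-map (z ∷_) (sublists L) _) (with-z j)))
    where
    sx′ = does (x ≟F z) ∨ sx
    sy′ = does (y ≟F z) ∨ sy
    with-z : ∀ j → ∑[ B ← sublists L ] (⟦ suc (length B) ≡ᵇ j ⟧
                                        * ⟦ (sx ∨ (does (x ≟F z) ∨ memb x B)) ∧ (sy ∨ (does (y ≟F z) ∨ memb y B)) ⟧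
                                        * χ a (z ⊕ sumF B))
                   ≡ shift (blockSum L (does (x ≟F z) ∨ sx) (does (y ≟F z) ∨ sy)) j * χ a z
    with-z zero    = ∑-zero (sublists L)
    with-z (suc j) = trans (∑-cong (sublists L) term) (trans (∑-*ˡ (sublists L) (χ a z) _) (ℤₚ.*-comm (χ a z) _))
      where
      term : ∀ B → ⟦ suc (length B) ≡ᵇ suc j ⟧ * ⟦ (sx ∨ (does (x ≟F z) ∨ memb x B)) ∧ (sy ∨ (does (y ≟F z) ∨ memb y B)) ⟧
                     * χ a (z ⊕ sumF B)
                 ≡ χ a z * (⟦ length B ≡ᵇ j ⟧ * ⟦ (sx′ ∨ memb x B) ∧ (sy′ ∨ memb y B) ⟧ * χ a (sumF B))
      term B rewrite ∨-rearrange sx (does (x ≟F z)) (memb x B) | ∨-rearrange sy (does (y ≟F z)) (memb y B)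
                   | χ-⊕ʳ a z (sumF B) =
        reorder ⟦ length B ≡ᵇ j ⟧ ⟦ (sx′ ∨ memb x B) ∧ (sy′ ∨ memb y B) ⟧ (χ a z) (χ a (sumF B))
        where
        reorder : ∀ p q r s → p * q * (r * s) ≡ r * (p * q * s)
        reorder = solve-∀

  forced : Bool → F m → Series → Series
  forced true  v f   = f
  forced false v f j = χ a v * shift f j

  unforced : List (F m) → Bool → Bool → Series
  unforced L sx sy = signProduct (map (dot a) (filterᵇ (keep x y sx sy) L))

  blockSumFormula : List (F m) → Bool → Bool → Series
  blockSumFormula L sx sy j = ⟦ sx ∨ memb x L ⟧ * ⟦ sy ∨ memb y L ⟧ * forced sx x (forced sy y (unforced L sx sy)) j

  forced-cong : ∀ s v {f g} → (∀ j → f j ≡ g j) → ∀ j → forced s v f j ≡ forced s v g j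
  forced-cong true  v f≗g j = f≗g j
  forced-cong false v f≗g j = cong (χ a v *_) (shift-cong f≗g j)

  forced-mul[1+ct] : ∀ s v c f j → forced s v (mul[1+ct] c f) j ≡ mul[1+ct] c (forced s v f) j
  forced-mul[1+ct] true  v c f j       = refl
  forced-mul[1+ct] false v c f zero    = zeros (χ a v) c
    where
    zeros : ∀ χv c → χv * + 0 ≡ χv * + 0 + c * + 0
    zeros = solve-∀
  forced-mul[1+ct] false v c f (suc j) = distrib (χ a v) (f j) c (shift f j)
    where
    distrib : ∀ χv p c q → χv * (p + c * q) ≡ χv * p + c * (χv * q)
    distrib = solve-∀

  forced-comm : ∀ s v t w f j → forced s v (forced t w f) j ≡ forced t w (forced s v f) j
  forced-comm true  v t     w f j       = refl
  forced-comm false v true  w f j       = refl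
  forced-comm false v false w f zero    = trans (ℤₚ.*-zeroʳ (χ a v)) (sym (ℤₚ.*-zeroʳ (χ a w)))
  forced-comm false v false w f (suc j) = trans (sym (ℤₚ.*-assoc (χ a v) _ _))
                                             (trans (cong (_* shift f j) (ℤₚ.*-comm (χ a v) (χ a w))) (ℤₚ.*-assoc (χ a w) _ _))

  scale-mul[1+ct] : ∀ I c f j → I * mul[1+ct] c f j ≡ I * f j + shift (λ i → I * f i) j * c
  scale-mul[1+ct] I c f j = trans (distrib I (f j) c (shift f j)) (cong (λ u → I * f j + u * c) (sym (shift-* I f j)))
    where
    distrib : ∀ I p c q → I * (p + c * q) ≡ I * p + I * q * c
    distrib = solve-∀

  mul[1+ct]-through-forced : ∀ I sx sy c f j →
    I * forced sx x (forced sy y (mul[1+ct] c f)) j ≡ I * forced sx x (forced sy y f) j + shift (λ i → I * forced sx x (forced sy y f) i) j * c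
  mul[1+ct]-through-forced I sx sy c f j =
    trans (cong (I *_) (trans (forced-cong sx x (forced-mul[1+ct] sy y c f) j) (forced-mul[1+ct] sx x c (forced sy y f) j)))
          (scale-mul[1+ct] I c (forced sx x (forced sy y f)) j)

  filterᵇ-cong : ∀ {p q : F m → Bool} L → (∀ z → z ∈ L → p z ≡ q z) → filterᵇ p L ≡ filterᵇ q L
  filterᵇ-cong []      p≗q = refl
  filterᵇ-cong {p} {q} (z ∷ L) p≗q with p z | q z | p≗q z (here refl)
  ... | true  | .true  | refl = cong (z ∷_) (filterᵇ-cong L (λ w → p≗q w ∘ there))
  ... | false | .false | refl = filterᵇ-cong L (λ w → p≗q w ∘ there)

  unforced-x-absent : x ∉ L → ∀ sy → unforced L false sy ≡ unforced L true sy
  unforced-x-absent {L} x∉L sy = cong (signProduct ∘ map (dot a)) (filterᵇ-cong L same)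
    where
    same : ∀ z → z ∈ L → keep x y false sy z ≡ keep x y true sy z
    same z z∈L with x ≟F z
    ... | yes refl = ⊥-elim (x∉L z∈L)
    ... | no _     = refl

  unforced-y-absent : y ∉ L → ∀ sx → unforced L sx false ≡ unforced L sx true
  unforced-y-absent {L} y∉L sx = cong (signProduct ∘ map (dot a)) (filterᵇ-cong L same)
    where
    same : ∀ z → z ∈ L → keep x y sx false z ≡ keep x y sx true z
    same z z∈L with y ≟F z
    ... | yes refl = ⊥-elim (y∉L z∈L)
    ... | no _     = refl

  add-forced : ∀ {Z} → Z ≡ + 0 → ∀ T I c f j → I * (c * shift f j) ≡ Z * T + shift (λ i → I * f i) j * c
  add-forced refl T I c f j = trans (rearrange T I c (shift f j)) (cong (λ u → + 0 * T + u * c) (sym (shift-* I f j)))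
    where
    rearrange : ∀ T I c s → I * (c * s) ≡ + 0 * T + I * s * c
    rearrange = solve-∀

  blockSumFormula-cons : x ≢ y → ∀ z L → z ∉ L → ∀ sx sy j →
    blockSumFormula (z ∷ L) sx sy j
      ≡ blockSumFormula L sx sy j + shift (blockSumFormula L (does (x ≟F z) ∨ sx) (does (y ≟F z) ∨ sy)) j * χ a z
  blockSumFormula-cons x≢y z L z∉L sx sy j with x ≟F z | y ≟F z
  ... | yes refl | yes refl = ⊥-elim (x≢y refl)
  ... | no _     | no _     = mul[1+ct]-through-forced (⟦ sx ∨ memb x L ⟧ * ⟦ sy ∨ memb y L ⟧) sx sy (χ a z) (unforced L sx sy) j
  ... | yes refl | no _ with sx
  ...   | true  = mul[1+ct]-through-forced (+ 1 * ⟦ sy ∨ memb y L ⟧) true sy (χ a x) (unforced L true sy) j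
  ...   | false rewrite memb-∉ z∉L | unforced-x-absent z∉L sy =
          add-forced {+ 0 * ⟦ sy ∨ memb y L ⟧} refl (+ 0) (+ 1 * ⟦ sy ∨ memb y L ⟧) (χ a x) (forced sy y (unforced L true sy)) j
  blockSumFormula-cons x≢y z L z∉L sx sy j | no _ | yes refl with sy
  ...   | true  = mul[1+ct]-through-forced (⟦ sx ∨ memb x L ⟧ * + 1) sx true (χ a y) (unforced L sx true) j
  ...   | false rewrite memb-∉ z∉L | unforced-y-absent z∉L sx =
          trans (cong (I *_) (forced-comm sx x false y (unforced L sx true) j))
                (add-forced (ℤₚ.*-zeroʳ ⟦ sx ∨ memb x L ⟧) _ I (χ a y) (forced sx x (unforced L sx true)) j)
    where
    I = ⟦ sx ∨ memb x L ⟧ * + 1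

  blockSum≡formula : x ≢ y → ∀ L → Unique L → ∀ sx sy j → blockSum L sx sy j ≡ blockSumFormula L sx sy j
  blockSum≡formula x≢y []      []            sx sy j = trans (blockSum-nil sx sy j) (empty sx sy)
    where
    empty : ∀ sx sy → one j * ⟦ sx ∧ sy ⟧ ≡ blockSumFormula [] sx sy j
    empty true  true  = trans (ℤₚ.*-identityʳ (one j)) (sym (ℤₚ.*-identityˡ (one j)))
    empty true  false = ℤₚ.*-zeroʳ (one j)
    empty false sy    = ℤₚ.*-zeroʳ (one j)
  blockSum≡formula x≢y (z ∷ L) (z∉L′ ∷ uniqL) sx sy j = begin
    blockSum (z ∷ L) sx sy j
      ≡⟨ blockSum-cons z L sx sy j ⟩
    blockSum L sx sy j + shift (blockSum L sx′ sy′) j * χ a z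
      ≡⟨ cong₂ (λ u v → u + v * χ a z) (blockSum≡formula x≢y L uniqL sx sy j)
                                        (shift-cong (blockSum≡formula x≢y L uniqL sx′ sy′) j) ⟩
    blockSumFormula L sx sy j + shift (blockSumFormula L sx′ sy′) j * χ a z
      ≡⟨ blockSumFormula-cons x≢y z L (All¬⇒¬Any z∉L′) sx sy j ⟨
    blockSumFormula (z ∷ L) sx sy j ∎
    where
    open ≡-Reasoning
    sx′ = does (x ≟F z) ∨ sx
    sy′ = does (y ≟F z) ∨ sy

does-≟-true : ∀ b → does (b Bool.≟ true) ≡ b
does-≟-true true  = refl
does-≟-true false = refl

pairCount-characterSum : ∀ m k (x y : F m) →
  + (2 ^ m) * + countPair m k x y ≡ ∑[ a ← allF m ] PairBlocks.blockSum a x y (nonzeroF m) false false k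
pairCount-characterSum m k x y = begin
  + (2 ^ m) * + countPair m k x y
    ≡⟨ cong (+ (2 ^ m) *_) (trans (length-filter≡∑ _ (W m k)) (∑-filter _ (sublists (nonzeroF m)) _)) ⟩
  + (2 ^ m) * ∑[ B ← sublists (nonzeroF m) ] (⟦ in-W B ⟧ * ⟦ does (memb x B ∧ memb y B Bool.≟ true) ⟧)
    ≡⟨ sym (∑-*ˡ (sublists (nonzeroF m)) (+ (2 ^ m)) _) ⟩
  ∑[ B ← sublists (nonzeroF m) ] (+ (2 ^ m) * (⟦ in-W B ⟧ * ⟦ does (memb x B ∧ memb y B Bool.≟ true) ⟧))
    ≡⟨ ∑-cong (sublists (nonzeroF m)) orthogonality ⟩
  ∑[ B ← sublists (nonzeroF m) ] ∑[ a ← allF m ] (⟦ length B ≡ᵇ k ⟧ * ⟦ memb x B ∧ memb y B ⟧ * χ a (sumF B))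
    ≡⟨ ∑-comm (sublists (nonzeroF m)) (allF m) _ ⟩
  ∑[ a ← allF m ] PairBlocks.blockSum a x y (nonzeroF m) false false k ∎
  where
  open ≡-Reasoning
  in-W : List (F m) → Bool
  in-W B = (length B ≡ᵇ k) ∧ does (sumF B ≟F 𝟎)
  orthogonality : ∀ B → + (2 ^ m) * (⟦ in-W B ⟧ * ⟦ does (memb x B ∧ memb y B Bool.≟ true) ⟧)
                        ≡ ∑[ a ← allF m ] (⟦ length B ≡ᵇ k ⟧ * ⟦ memb x B ∧ memb y B ⟧ * χ a (sumF B))
  orthogonality B
    rewrite does-≟-true (memb x B ∧ memb y B) | ⟦∧⟧ (length B ≡ᵇ k) (does (sumF B ≟F 𝟎))
          | ∑-*ˡ (allF m) (⟦ length B ≡ᵇ k ⟧ * ⟦ memb x B ∧ memb y B ⟧) (λ a → χ a (sumF B)) | ∑-χ m (sumF B) =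
    rearrange (+ (2 ^ m)) ⟦ length B ≡ᵇ k ⟧ ⟦ does (sumF B ≟F 𝟎) ⟧ ⟦ memb x B ∧ memb y B ⟧
    where
    rearrange : ∀ N l s p → N * (l * s * p) ≡ l * p * (N * s)
    rearrange = solve-∀

count-∑ : ∀ b (f : A → Bool) L → + count b (map f L) ≡ ∑[ z ← L ] ⟦ does (f z Bool.≟ b) ⟧
count-∑ b f []      = refl
count-∑ b f (z ∷ L) with does (f z Bool.≟ b)
... | true  = cong (_+_ (+ 1)) (count-∑ b f L)
... | false = trans (count-∑ b f L) (sym (ℤₚ.+-identityˡ _))

≟F-sym : ∀ (u v : F m) → does (u ≟F v) ≡ does (v ≟F u)
≟F-sym u v with u ≟F v | v ≟F u
... | yes _    | yes _    = refl
... | no _     | no _     = refl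
... | yes refl | no u≢u   = ⊥-elim (u≢u refl)
... | no u≢v   | yes refl = ⊥-elim (u≢v refl)

⟦memb⟧ : ∀ {R : List (F m)} → Unique R → ∀ z → ⟦ memb z R ⟧ ≡ ∑[ r ← R ] ⟦ does (z ≟F r) ⟧
⟦memb⟧ []               z = refl
⟦memb⟧ {R = r ∷ R} (r∉R ∷ uniqR) z with z ≟F r
... | yes refl = cong (_+_ (+ 1)) (trans (cong ⟦_⟧ (sym (memb-∉ (All¬⇒¬Any r∉R)))) (⟦memb⟧ uniqR z))
... | no _     = trans (⟦memb⟧ uniqR z) (sym (ℤₚ.+-identityˡ _))

∑-allF-≟ : ∀ m (v : F m) (g : F m → ℤ) → ∑[ z ← allF m ] (⟦ does (z ≟F v) ⟧ * g z) ≡ g v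
∑-allF-≟ zero    []          g = trans (ℤₚ.+-identityʳ _) (ℤₚ.*-identityˡ (g []))
∑-allF-≟ (suc m) (false ∷ v) g =
  trans (∑-allF-suc m _) (trans (cong₂ _+_ (∑-allF-≟ m v (g ∘ (false ∷_))) (∑-zero (allF m))) (ℤₚ.+-identityʳ _))
∑-allF-≟ (suc m) (true ∷ v)  g =
  trans (∑-allF-suc m _) (trans (cong₂ _+_ (∑-zero (allF m)) (∑-allF-≟ m v (g ∘ (true ∷_)))) (ℤₚ.+-identityˡ _))

-- Shaped to match keep x y false false z and memb z (x ∷ y ∷ 𝟎 ∷ []).
⟦none-of-three⟧ : ∀ p q r → ⟦ not r ⟧ * ⟦ (not p ∨ false) ∧ (not q ∨ false) ⟧ ≡ + 1 - ⟦ p ∨ (q ∨ (r ∨ false)) ⟧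
⟦none-of-three⟧ true  true  true  = refl
⟦none-of-three⟧ true  true  false = refl
⟦none-of-three⟧ true  false true  = refl
⟦none-of-three⟧ true  false false = refl
⟦none-of-three⟧ false true  true  = refl
⟦none-of-three⟧ false true  false = refl
⟦none-of-three⟧ false false true  = refl
⟦none-of-three⟧ false false false = refl

∈nonzeroF⇒≢𝟎 : ∀ {v : F m} → v ∈ nonzeroF m → v ≢ 𝟎
∈nonzeroF⇒≢𝟎 {m} v∈ = proj₂ (∈-filter⁻ (λ v → ¬? (v ≟F 𝟎)) {xs = allF m} v∈)

∑-nonzeroExcept : ∀ {x y : F m} → x ∈ nonzeroF m → y ∈ nonzeroF m → x ≢ y → ∀ g →
  ∑ (nonzeroExcept x y) g ≡ ∑ (allF m) g - ∑ (x ∷ y ∷ 𝟎 ∷ []) g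
∑-nonzeroExcept {m} {x} {y} x∈ y∈ x≢y g = begin
  ∑ (nonzeroExcept x y) g
    ≡⟨ ∑-filter (T? ∘ keep x y false false) (nonzeroF m) g ⟩
  ∑[ z ← nonzeroF m ] (⟦ keep x y false false z ⟧ * g z)
    ≡⟨ ∑-filter (λ v → ¬? (v ≟F 𝟎)) (allF m) _ ⟩
  ∑[ z ← allF m ] (⟦ not (does (z ≟F 𝟎)) ⟧ * (⟦ keep x y false false z ⟧ * g z))
    ≡⟨ ∑-cong (allF m) pointwise ⟩
  ∑[ z ← allF m ] (g z - ⟦ memb z R ⟧ * g z)
    ≡⟨ ∑-- (allF m) g (λ z → ⟦ memb z R ⟧ * g z) ⟩
  ∑ (allF m) g - ∑[ z ← allF m ] (⟦ memb z R ⟧ * g z)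
    ≡⟨ cong (_-_ (∑ (allF m) g)) removed ⟩
  ∑ (allF m) g - ∑ R g ∎
  where
  open ≡-Reasoning
  R = x ∷ y ∷ 𝟎 ∷ []
  uniqR : Unique R
  uniqR = (x≢y ∷ ∈nonzeroF⇒≢𝟎 x∈ ∷ []) ∷ (∈nonzeroF⇒≢𝟎 y∈ ∷ []) ∷ [] ∷ []
  pointwise : ∀ z → ⟦ not (does (z ≟F 𝟎)) ⟧ * (⟦ keep x y false false z ⟧ * g z) ≡ g z - ⟦ memb z R ⟧ * g z
  pointwise z =
    trans (sym (ℤₚ.*-assoc ⟦ not (does (z ≟F 𝟎)) ⟧ ⟦ keep x y false false z ⟧ (g z)))
          (trans (cong (_* g z) none) (distrib ⟦ memb z R ⟧ (g z)))
    where
    none : ⟦ not (does (z ≟F 𝟎)) ⟧ * ⟦ keep x y false false z ⟧ ≡ + 1 - ⟦ memb z R ⟧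
    none = trans (⟦none-of-three⟧ (does (x ≟F z)) (does (y ≟F z)) (does (z ≟F 𝟎)))
                 (cong₂ (λ p q → + 1 - ⟦ p ∨ (q ∨ (does (z ≟F 𝟎) ∨ false)) ⟧) (≟F-sym x z) (≟F-sym y z))
    distrib : ∀ M g → (+ 1 - M) * g ≡ g - M * g
    distrib = solve-∀
  removed : ∑[ z ← allF m ] (⟦ memb z R ⟧ * g z) ≡ ∑ R g
  removed = begin
    ∑[ z ← allF m ] (⟦ memb z R ⟧ * g z)
      ≡⟨ ∑-cong (allF m) (λ z → trans (cong (_* g z) (⟦memb⟧ uniqR z)) (∑-*ʳ R (λ r → ⟦ does (z ≟F r) ⟧) (g z))) ⟩
    ∑[ z ← allF m ] ∑[ r ← R ] (⟦ does (z ≟F r) ⟧ * g z)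
      ≡⟨ ∑-comm (allF m) R (λ z r → ⟦ does (z ≟F r) ⟧ * g z) ⟩
    ∑[ r ← R ] ∑[ z ← allF m ] (⟦ does (z ≟F r) ⟧ * g z)
      ≡⟨ ∑-cong R (λ r → ∑-allF-≟ m r g) ⟩
    ∑ R g ∎

count-nonzeroExcept : ∀ {x y : F m} → x ∈ nonzeroF m → y ∈ nonzeroF m → x ≢ y → ∀ a b →
  count b (map (dot a) (nonzeroExcept x y)) ℕ.+ count b (map (dot a) (x ∷ y ∷ 𝟎 ∷ [])) ≡ count b (map (dot a) (allF m))
count-nonzeroExcept {m} {x} {y} x∈ y∈ x≢y a b = ℤₚ.+-injective (begin
  + (count b (map (dot a) (nonzeroExcept x y)) ℕ.+ count b (map (dot a) R))
    ≡⟨ ℤₚ.pos-+ (count b (map (dot a) (nonzeroExcept x y))) (count b (map (dot a) R)) ⟩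
  + count b (map (dot a) (nonzeroExcept x y)) + + count b (map (dot a) R)
    ≡⟨ cong₂ _+_ (trans (count-∑ b (dot a) (nonzeroExcept x y)) (∑-nonzeroExcept x∈ y∈ x≢y g)) (count-∑ b (dot a) R) ⟩
  ∑ (allF m) g - ∑ R g + ∑ R g
    ≡⟨ cancel (∑ (allF m) g) (∑ R g) ⟩
  ∑ (allF m) g
    ≡⟨ count-∑ b (dot a) (allF m) ⟨
  + count b (map (dot a) (allF m)) ∎)
  where
  open ≡-Reasoning
  R = x ∷ y ∷ 𝟎 ∷ []
  g : F m → ℤ
  g z = ⟦ does (dot a z Bool.≟ b) ⟧
  cancel : ∀ u v → u - v + v ≡ u
  cancel = solve-∀

unique-allF : ∀ m → Unique (allF m)
unique-allF zero    = [] ∷ []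
unique-allF (suc m) = Uniqueₚ.++⁺ (Uniqueₚ.map⁺ ∷-injectiveʳ (unique-allF m)) (Uniqueₚ.map⁺ ∷-injectiveʳ (unique-allF m)) disjoint
  where
  disjoint : ∀ {v} → ¬ (v ∈ map (false ∷_) (allF m) × v ∈ map (true ∷_) (allF m))
  disjoint (v∈f , v∈t) with ∈-map⁻ (false ∷_) v∈f | ∈-map⁻ (true ∷_) v∈t
  ... | _ , _ , refl | _ , _ , ()

unique-nonzeroF : ∀ m → Unique (nonzeroF m)
unique-nonzeroF m = Uniqueₚ.filter⁺ (λ v → ¬? (v ≟F 𝟎)) (unique-allF m)

blockSum-nonzeroF : ∀ {x y : F m} → x ∈ nonzeroF m → y ∈ nonzeroF m → x ≢ y → ∀ a j →
  PairBlocks.blockSum a x y (nonzeroF m) false false (2 ℕ.+ j)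
    ≡ χ a x * χ a y * powSeries (count false (map (dot a) (nonzeroExcept x y))) (count true (map (dot a) (nonzeroExcept x y))) j
blockSum-nonzeroF {m} {x} {y} x∈ y∈ x≢y a j = begin
  PairBlocks.blockSum a x y (nonzeroF m) false false (2 ℕ.+ j)
    ≡⟨ PairBlocks.blockSum≡formula a x y x≢y (nonzeroF m) (unique-nonzeroF m) false false (2 ℕ.+ j) ⟩
  ⟦ memb x (nonzeroF m) ⟧ * ⟦ memb y (nonzeroF m) ⟧ * (χ a x * (χ a y * P j))
    ≡⟨ cong₂ (λ p q → ⟦ p ⟧ * ⟦ q ⟧ * (χ a x * (χ a y * P j))) (memb-∈ x∈) (memb-∈ y∈) ⟩
  + 1 * + 1 * (χ a x * (χ a y * P j))
    ≡⟨ reassociate (χ a x) (χ a y) (P j) ⟩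
  χ a x * χ a y * P j
    ≡⟨ cong (χ a x * χ a y *_) (signProduct-count (map (dot a) (nonzeroExcept x y)) j) ⟩
  χ a x * χ a y * powSeries (count false (map (dot a) (nonzeroExcept x y))) (count true (map (dot a) (nonzeroExcept x y))) j ∎
  where
  open ≡-Reasoning
  P = signProduct (map (dot a) (nonzeroExcept x y))
  reassociate : ∀ u v p → + 1 * + 1 * (u * (v * p)) ≡ u * v * p
  reassociate = solve-∀

count-dot-𝟎 : ∀ b (L : List (F m)) → count b (map (dot 𝟎) L) ≡ (if b then 0 else length L)
count-dot-𝟎 true  []      = refl
count-dot-𝟎 false []      = refl
count-dot-𝟎 true  (v ∷ L) rewrite dot-𝟎ˡ v = count-dot-𝟎 true L
count-dot-𝟎 false (v ∷ L) rewrite dot-𝟎ˡ v = cong suc (count-dot-𝟎 false L)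

characterValue : ℕ → Bool → Bool → Series
characterValue h dx dy j =
  sign dx * sign dy * powSeries (h ∸ count false (dx ∷ dy ∷ false ∷ [])) (h ∸ count true (dx ∷ dy ∷ false ∷ [])) j

∑Bool² : (Bool → Bool → ℤ) → ℤ
∑Bool² h = h false false + h false true + h true false + h true true

sign-expansion : ∀ (h : Bool → Bool → ℤ) dx dy → + 4 * h dx dy ≡
  ∑Bool² h + (h false false + h false true - h true false - h true true) * sign dx
          + (h false false - h false true + h true false - h true true) * sign dy
          + (h false false - h false true - h true false + h true true) * (sign dx * sign dy)
sign-expansion h false false = expansion (h false false) (h false true) (h true false) (h true true)
  where
  expansion : ∀ a b c d → + 4 * a ≡ a + b + c + d + (a + b - c - d) * + 1 + (a - b + c - d) * + 1 + (a - b - c + d) * (+ 1 * + 1)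
  expansion = solve-∀
sign-expansion h false true  = expansion (h false false) (h false true) (h true false) (h true true)
  where
  expansion : ∀ a b c d → + 4 * b ≡ a + b + c + d + (a + b - c - d) * + 1 + (a - b + c - d) * -1ℤ + (a - b - c + d) * (+ 1 * -1ℤ)
  expansion = solve-∀
sign-expansion h true  false = expansion (h false false) (h false true) (h true false) (h true true)
  where
  expansion : ∀ a b c d → + 4 * c ≡ a + b + c + d + (a + b - c - d) * -1ℤ + (a - b + c - d) * + 1 + (a - b - c + d) * (-1ℤ * + 1)
  expansion = solve-∀
sign-expansion h true  true  = expansion (h false false) (h false true) (h true false) (h true true)
  where
  expansion : ∀ a b c d → + 4 * d ≡ a + b + c + d + (a + b - c - d) * -1ℤ + (a - b + c - d) * -1ℤ + (a - b - c + d) * (-1ℤ * -1ℤ)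
  expansion = solve-∀

⊕≡𝟎⇒≡ : ∀ (u v : F m) → u ⊕ v ≡ 𝟎 → u ≡ v
⊕≡𝟎⇒≡ []          []          _   = refl
⊕≡𝟎⇒≡ (true ∷ u)  (true ∷ v)  u⊕v≡𝟎 = cong (true ∷_) (⊕≡𝟎⇒≡ u v (∷-injectiveʳ u⊕v≡𝟎))
⊕≡𝟎⇒≡ (false ∷ u) (false ∷ v) u⊕v≡𝟎 = cong (false ∷_) (⊕≡𝟎⇒≡ u v (∷-injectiveʳ u⊕v≡𝟎))

∑-dot-pair : ∀ m (x y : F m) → x ≢ 𝟎 → y ≢ 𝟎 → x ≢ y → (h : Bool → Bool → ℤ) →
  + 4 * ∑[ a ← allF m ] h (dot a x) (dot a y) ≡ + (2 ^ m) * ∑Bool² h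
∑-dot-pair m x y x≢𝟎 y≢𝟎 x≢y h = begin
  + 4 * ∑[ a ← allF m ] h (dot a x) (dot a y)
    ≡⟨ sym (∑-*ˡ (allF m) (+ 4) _) ⟩
  ∑[ a ← allF m ] (+ 4 * h (dot a x) (dot a y))
    ≡⟨ ∑-cong (allF m) (λ a → trans (sign-expansion h (dot a x) (dot a y))
                                    (cong (λ s → S₀ + S₁ * χ a x + S₂ * χ a y + S₃ * s) (sym (χ-⊕ʳ a x y)))) ⟩
  ∑[ a ← allF m ] (S₀ + S₁ * χ a x + S₂ * χ a y + S₃ * χ a (x ⊕ y))
    ≡⟨ trans (∑-+ (allF m) _ _) (cong₂ _+_ (trans (∑-+ (allF m) _ _) (cong₂ _+_ (∑-+ (allF m) _ _) (∑-*ˡ (allF m) S₂ _)))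
                                                (∑-*ˡ (allF m) S₃ _)) ⟩
  ∑[ _ ← allF m ] S₀ + ∑[ a ← allF m ] (S₁ * χ a x) + S₂ * ∑[ a ← allF m ] χ a y + S₃ * ∑[ a ← allF m ] χ a (x ⊕ y)
    ≡⟨ cong₂ _+_ (cong₂ _+_ (cong₂ _+_ (trans (∑-const (allF m) S₀) (cong (λ n → + n * S₀) (length-allF m)))
                                        (trans (∑-*ˡ (allF m) S₁ _) (cong (S₁ *_) (∑-χ-≢𝟎 m x x≢𝟎))))
                            (cong (S₂ *_) (∑-χ-≢𝟎 m y y≢𝟎)))
                 (cong (S₃ *_) (∑-χ-≢𝟎 m (x ⊕ y) (x≢y ∘ ⊕≡𝟎⇒≡ x y))) ⟩
  + (2 ^ m) * S₀ + S₁ * + 0 + S₂ * + 0 + S₃ * + 0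
    ≡⟨ vanish (+ (2 ^ m)) S₀ S₁ S₂ S₃ ⟩
  + (2 ^ m) * S₀ ∎
  where
  open ≡-Reasoning
  S₀ = ∑Bool² h
  S₁ = h false false + h false true - h true false - h true true
  S₂ = h false false - h false true + h true false - h true true
  S₃ = h false false - h false true - h true false + h true true
  vanish : ∀ N s₀ s₁ s₂ s₃ → N * s₀ + s₁ * + 0 + s₂ * + 0 + s₃ * + 0 ≡ N * s₀
  vanish = solve-∀

module CharacterTerms {m₁} {x y : F (suc m₁)} (x∈ : x ∈ nonzeroF (suc m₁)) (y∈ : y ∈ nonzeroF (suc m₁)) (x≢y : x ≢ y) where

  count-remaining : ∀ a b →
    count b (map (dot a) (nonzeroExcept x y)) ≡ count b (map (dot a) (allF (suc m₁))) ∸ count b (dot a x ∷ dot a y ∷ false ∷ [])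
  count-remaining a b = begin
    count b (map (dot a) (nonzeroExcept x y))
      ≡⟨ ℕₚ.m+n∸n≡m _ (count b removed) ⟨
    count b (map (dot a) (nonzeroExcept x y)) ℕ.+ count b removed ∸ count b removed
      ≡⟨ cong (_∸ count b removed) (count-nonzeroExcept x∈ y∈ x≢y a b) ⟩
    count b (map (dot a) (allF (suc m₁))) ∸ count b removed
      ≡⟨ cong (λ d → count b (map (dot a) (allF (suc m₁))) ∸ count b (dot a x ∷ dot a y ∷ d ∷ [])) (dot-𝟎ʳ a) ⟩
    count b (map (dot a) (allF (suc m₁))) ∸ count b (dot a x ∷ dot a y ∷ false ∷ []) ∎
    where
    open ≡-Reasoning
    removed = map (dot a) (x ∷ y ∷ 𝟎 ∷ [])

  characterTerm-≢𝟎 : ∀ a → a ≢ 𝟎 → ∀ j →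
    PairBlocks.blockSum a x y (nonzeroF (suc m₁)) false false (2 ℕ.+ j) ≡ characterValue (2 ^ m₁) (dot a x) (dot a y) j
  characterTerm-≢𝟎 a a≢𝟎 j =
    trans (blockSum-nonzeroF x∈ y∈ x≢y a j)
          (cong₂ (λ p q → χ a x * χ a y * powSeries p q j) (count-half false) (count-half true))
    where
    count-half : ∀ b → count b (map (dot a) (nonzeroExcept x y)) ≡ 2 ^ m₁ ∸ count b (dot a x ∷ dot a y ∷ false ∷ [])
    count-half b = trans (count-remaining a b) (cong (_∸ count b (dot a x ∷ dot a y ∷ false ∷ [])) (count-dot-≢𝟎 m₁ b a a≢𝟎))

  characterTerm-𝟎 : ∀ j → PairBlocks.blockSum 𝟎 x y (nonzeroF (suc m₁)) false false (2 ℕ.+ j) ≡ powSeries (2 ^ suc m₁ ∸ 3) 0 j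
  characterTerm-𝟎 j = begin
    PairBlocks.blockSum 𝟎 x y (nonzeroF (suc m₁)) false false (2 ℕ.+ j)
      ≡⟨ blockSum-nonzeroF x∈ y∈ x≢y 𝟎 j ⟩
    χ 𝟎 x * χ 𝟎 y * powSeries (count false remaining) (count true remaining) j
      ≡⟨ cong₂ (λ u v → sign u * sign v * powSeries (count false remaining) (count true remaining) j) (dot-𝟎ˡ x) (dot-𝟎ˡ y) ⟩
    + 1 * + 1 * powSeries (count false remaining) (count true remaining) j
      ≡⟨ ℤₚ.*-identityˡ _ ⟩
    powSeries (count false remaining) (count true remaining) j
      ≡⟨ cong₂ (λ p q → powSeries p q j) (trans (count-remaining 𝟎 false) all-false) (trans (count-remaining 𝟎 true) none-true) ⟩
    powSeries (2 ^ suc m₁ ∸ 3) 0 j ∎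
    where
    open ≡-Reasoning
    remaining = map (dot 𝟎) (nonzeroExcept x y)
    all-false : count false (map (dot 𝟎) (allF (suc m₁))) ∸ count false (dot 𝟎 x ∷ dot 𝟎 y ∷ false ∷ []) ≡ 2 ^ suc m₁ ∸ 3
    all-false rewrite dot-𝟎ˡ x | dot-𝟎ˡ y = cong (_∸ 3) (trans (count-dot-𝟎 false (allF (suc m₁))) (length-allF (suc m₁)))
    none-true : count true (map (dot 𝟎) (allF (suc m₁))) ∸ count true (dot 𝟎 x ∷ dot 𝟎 y ∷ false ∷ []) ≡ 0
    none-true rewrite dot-𝟎ˡ x | dot-𝟎ˡ y = cong (_∸ 0) (count-dot-𝟎 true (allF (suc m₁)))

  characterTerm : ∀ a j → PairBlocks.blockSum a x y (nonzeroF (suc m₁)) false false (2 ℕ.+ j)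
    ≡ ⟦ does (a ≟F 𝟎) ⟧ * (powSeries (2 ^ suc m₁ ∸ 3) 0 j - characterValue (2 ^ m₁) false false j)
      + characterValue (2 ^ m₁) (dot a x) (dot a y) j
  characterTerm a j with a ≟F 𝟎
  ... | no a≢𝟎   = trans (characterTerm-≢𝟎 a a≢𝟎 j) (sym (ℤₚ.+-identityˡ _))
  ... | yes refl rewrite dot-𝟎ˡ x | dot-𝟎ˡ y =
    trans (characterTerm-𝟎 j) (restore (powSeries (2 ^ suc m₁ ∸ 3) 0 j) (characterValue (2 ^ m₁) false false j))
    where
    restore : ∀ b h → b ≡ + 1 * (b - h) + h
    restore = solve-∀

  pairCount-formula : ∀ j → + 4 * (+ (2 ^ suc m₁) * + countPair (suc m₁) (2 ℕ.+ j) x y)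
    ≡ + 4 * (powSeries (2 ^ suc m₁ ∸ 3) 0 j - characterValue (2 ^ m₁) false false j)
      + + (2 ^ suc m₁) * ∑Bool² (λ dx dy → characterValue (2 ^ m₁) dx dy j)
  pairCount-formula j = begin
    + 4 * (+ (2 ^ suc m₁) * + countPair (suc m₁) (2 ℕ.+ j) x y)
      ≡⟨ cong (+ 4 *_) (trans (pairCount-characterSum (suc m₁) (2 ℕ.+ j) x y) (∑-cong (allF (suc m₁)) (λ a → characterTerm a j))) ⟩
    + 4 * ∑[ a ← allF (suc m₁) ] (⟦ does (a ≟F 𝟎) ⟧ * c + H (dot a x) (dot a y))
      ≡⟨ cong (+ 4 *_) (trans (∑-+ (allF (suc m₁)) _ _) (cong (_+ ∑[ a ← allF (suc m₁) ] H (dot a x) (dot a y)) origin)) ⟩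
    + 4 * (c + ∑[ a ← allF (suc m₁) ] H (dot a x) (dot a y))
      ≡⟨ ℤₚ.*-distribˡ-+ (+ 4) c _ ⟩
    + 4 * c + + 4 * ∑[ a ← allF (suc m₁) ] H (dot a x) (dot a y)
      ≡⟨ cong (_+_ (+ 4 * c)) (∑-dot-pair (suc m₁) x y (∈nonzeroF⇒≢𝟎 x∈) (∈nonzeroF⇒≢𝟎 y∈) x≢y H) ⟩
    + 4 * c + + (2 ^ suc m₁) * ∑Bool² H ∎
    where
    open ≡-Reasoning
    c = powSeries (2 ^ suc m₁ ∸ 3) 0 j - characterValue (2 ^ m₁) false false j
    H : Bool → Bool → ℤ
    H dx dy = characterValue (2 ^ m₁) dx dy j
    origin : ∑[ a ← allF (suc m₁) ] (⟦ does (a ≟F 𝟎) ⟧ * c) ≡ c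
    origin = trans (sym (∑-*ʳ (allF (suc m₁)) _ c)) (trans (cong (_* c) (∑-⟦≟𝟎⟧ (suc m₁))) (ℤₚ.*-identityˡ c))

mul[1-t²] : Series → Series
mul[1-t²] f j = f j - shift (shift f) j

Q : ℕ → Series
Q zero    = one
Q (suc r) = mul[1-t²] (Q r)

mul[1-t²]-cong : ∀ {f g} → (∀ j → f j ≡ g j) → ∀ j → mul[1-t²] f j ≡ mul[1-t²] g j
mul[1-t²]-cong f≗g j = cong₂ _-_ (f≗g j) (shift-cong (shift-cong f≗g) j)

shift-mul[1+ct] : ∀ c f j → shift (mul[1+ct] c f) j ≡ shift f j + c * shift (shift f) j
shift-mul[1+ct] c f zero    = sym (trans (ℤₚ.+-identityˡ _) (ℤₚ.*-zeroʳ c))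
shift-mul[1+ct] c f (suc j) = refl

shift²-mul[1+ct] : ∀ c f j → shift (shift (mul[1+ct] c f)) j ≡ shift (shift f) j + c * shift (shift (shift f)) j
shift²-mul[1+ct] c f zero    = sym (trans (ℤₚ.+-identityˡ _) (ℤₚ.*-zeroʳ c))
shift²-mul[1+ct] c f (suc j) = shift-mul[1+ct] c f j

powSeries-suc-suc : ∀ p q j → powSeries (suc p) (suc q) j ≡ mul[1-t²] (powSeries p q) j
powSeries-suc-suc p q j = begin
  mul[1+ct] (+ 1) (powSeries p (suc q)) j
    ≡⟨ mul[1+ct]-cong (+ 1) (powSeries-sucʳ p q) j ⟩
  f j + -1ℤ * shift f j + + 1 * shift (mul[1+ct] -1ℤ f) j
    ≡⟨ cong (λ u → f j + -1ℤ * shift f j + + 1 * u) (shift-mul[1+ct] -1ℤ f j) ⟩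
  f j + -1ℤ * shift f j + + 1 * (shift f j + -1ℤ * shift (shift f) j)
    ≡⟨ telescope (f j) (shift f j) (shift (shift f) j) ⟩
  mul[1-t²] f j ∎
  where
  open ≡-Reasoning
  f = powSeries p q
  telescope : ∀ a b c → a + -1ℤ * b + + 1 * (b + -1ℤ * c) ≡ a - c
  telescope = solve-∀

powSeries-diag : ∀ r j → powSeries r r j ≡ Q r j
powSeries-diag zero    j = refl
powSeries-diag (suc r) j = trans (powSeries-suc-suc r r j) (mul[1-t²]-cong (powSeries-diag r) j)

powSeries-binomial : ∀ n j → powSeries n 0 j ≡ + (n C j)
powSeries-binomial zero    zero    = refl
powSeries-binomial zero    (suc j) = refl
powSeries-binomial (suc n) zero    = trans (ℤₚ.+-identityʳ _) (powSeries-binomial n 0)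
powSeries-binomial (suc n) (suc j) =
  trans (cong₂ (λ u v → u + + 1 * v) (powSeries-binomial n (suc j)) (powSeries-binomial n j))
        (trans (cong (_+_ (+ (n C suc j))) (ℤₚ.*-identityˡ (+ (n C j))))
               (trans (ℤₚ.+-comm (+ (n C suc j)) (+ (n C j))) (cong +_ (nCk+nC[k+1]≡[n+1]C[k+1] n j))))

mul[1+ct]³ : ∀ a b c f j → mul[1+ct] a (mul[1+ct] b (mul[1+ct] c f)) j
  ≡ f j + (a + b + c) * shift f j + (a * b + a * c + b * c) * shift (shift f) j + a * b * c * shift (shift (shift f)) j
mul[1+ct]³ a b c f j = begin
  outer j + a * shift outer j
    ≡⟨ cong (λ u → outer j + a * u) (shift-mul[1+ct] b inner j) ⟩
  inner j + b * shift inner j + a * (shift inner j + b * shift (shift inner) j)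
    ≡⟨ cong₂ (λ u v → inner j + b * u + a * (u + b * v)) (shift-mul[1+ct] c f j) (shift²-mul[1+ct] c f j) ⟩
  f j + c * s₁ + b * (s₁ + c * s₂) + a * (s₁ + c * s₂ + b * (s₂ + c * s₃))
    ≡⟨ expand (f j) s₁ s₂ s₃ a b c ⟩
  f j + (a + b + c) * s₁ + (a * b + a * c + b * c) * s₂ + a * b * c * s₃ ∎
  where
  open ≡-Reasoning
  inner = mul[1+ct] c f
  outer = mul[1+ct] b inner
  s₁ = shift f j
  s₂ = shift (shift f) j
  s₃ = shift (shift (shift f)) j
  expand : ∀ f₀ s₁ s₂ s₃ a b c → f₀ + c * s₁ + b * (s₁ + c * s₂) + a * (s₁ + c * s₂ + b * (s₂ + c * s₃))
                                 ≡ f₀ + (a + b + c) * s₁ + (a * b + a * c + b * c) * s₂ + a * b * c * s₃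
  expand = solve-∀

mul[1-t]^ : ℕ → Series → Series
mul[1-t]^ zero    f = f
mul[1-t]^ (suc q) f = mul[1+ct] -1ℤ (mul[1-t]^ q f)

powSeries-offDiag : ∀ q r j → powSeries r (q ℕ.+ r) j ≡ mul[1-t]^ q (Q r) j
powSeries-offDiag zero    r j = powSeries-diag r j
powSeries-offDiag (suc q) r j = trans (powSeries-sucʳ r (q ℕ.+ r) j) (mul[1+ct]-cong -1ℤ (powSeries-offDiag q r) j)

shift^ : ℕ → Series → Series
shift^ zero    f = f
shift^ (suc k) f = shift (shift^ k f)

characterValue-ff : ∀ r j → characterValue (3 ℕ.+ r) false false j ≡ Q r j - + 3 * shift^ 1 (Q r) j + + 3 * shift^ 2 (Q r) j - shift^ 3 (Q r) j
characterValue-ff r j =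
  trans (ℤₚ.*-identityˡ _) (trans (powSeries-offDiag 3 r j) (trans (mul[1+ct]³ -1ℤ -1ℤ -1ℤ (Q r) j)
        (collect (Q r j) (shift^ 1 (Q r) j) (shift^ 2 (Q r) j) (shift^ 3 (Q r) j))))
  where
  collect : ∀ q₀ q₁ q₂ q₃ →
    q₀ + (-1ℤ + -1ℤ + -1ℤ) * q₁ + (-1ℤ * -1ℤ + -1ℤ * -1ℤ + -1ℤ * -1ℤ) * q₂ + -1ℤ * -1ℤ * -1ℤ * q₃
      ≡ q₀ - + 3 * q₁ + + 3 * q₂ - q₃
  collect = solve-∀

characterValue-total : ∀ r j → ∑Bool² (λ dx dy → characterValue (3 ℕ.+ r) dx dy j) ≡ + 4 * (shift^ 2 (Q r) j - shift^ 3 (Q r) j)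
characterValue-total r j = begin
  combine P₀₃ P₁₂ P₂₁                                          ≡⟨ cong₂ (λ u v → combine u v P₂₁) ff ft ⟩
  combine (E -1ℤ -1ℤ -1ℤ) (E (+ 1) -1ℤ -1ℤ) P₂₁                ≡⟨ cong (combine (E -1ℤ -1ℤ -1ℤ) (E (+ 1) -1ℤ -1ℤ)) tt ⟩
  combine (E -1ℤ -1ℤ -1ℤ) (E (+ 1) -1ℤ -1ℤ) (E (+ 1) (+ 1) -1ℤ) ≡⟨ collect (Q r j) (shift^ 1 (Q r) j) (shift^ 2 (Q r) j) (shift^ 3 (Q r) j) ⟩
  + 4 * (shift^ 2 (Q r) j - shift^ 3 (Q r) j)                  ∎
  where
  open ≡-Reasoning
  combine : ℤ → ℤ → ℤ → ℤ
  combine u v w = + 1 * + 1 * u + + 1 * -1ℤ * v + -1ℤ * + 1 * v + -1ℤ * -1ℤ * w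
  P₀₃ = powSeries r (3 ℕ.+ r) j
  P₁₂ = powSeries (1 ℕ.+ r) (2 ℕ.+ r) j
  P₂₁ = powSeries (2 ℕ.+ r) (1 ℕ.+ r) j
  E : ℤ → ℤ → ℤ → ℤ
  E a b c = Q r j + (a + b + c) * shift^ 1 (Q r) j + (a * b + a * c + b * c) * shift^ 2 (Q r) j + a * b * c * shift^ 3 (Q r) j
  ff : P₀₃ ≡ E -1ℤ -1ℤ -1ℤ
  ff = trans (powSeries-offDiag 3 r j) (mul[1+ct]³ -1ℤ -1ℤ -1ℤ (Q r) j)
  ft : P₁₂ ≡ E (+ 1) -1ℤ -1ℤ
  ft = trans (mul[1+ct]-cong (+ 1) (powSeries-offDiag 2 r) j) (mul[1+ct]³ (+ 1) -1ℤ -1ℤ (Q r) j)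
  tt : P₂₁ ≡ E (+ 1) (+ 1) -1ℤ
  tt = trans (mul[1+ct]-cong (+ 1) (mul[1+ct]-cong (+ 1) (powSeries-offDiag 1 r)) j) (mul[1+ct]³ (+ 1) (+ 1) -1ℤ (Q r) j)
  collect : ∀ q₀ q₁ q₂ q₃ →
    let E : ℤ → ℤ → ℤ → ℤ
        E a b c = q₀ + (a + b + c) * q₁ + (a * b + a * c + b * c) * q₂ + a * b * c * q₃
    in + 1 * + 1 * E -1ℤ -1ℤ -1ℤ + + 1 * -1ℤ * E (+ 1) -1ℤ -1ℤ + -1ℤ * + 1 * E (+ 1) -1ℤ -1ℤ + -1ℤ * -1ℤ * E (+ 1) (+ 1) -1ℤ
       ≡ + 4 * (q₂ - q₃)
  collect = solve-∀

2r+3 : ℕ → ℕ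
2r+3 r = 3 ℕ.+ (r ℕ.+ r)

-- Λ r j = 2^m λ_(j+2) when 2^(m-1) = r + 3.
Λ : ℕ → Series
Λ r j = + (2r+3 r C j) - (Q r j - + 3 * shift^ 1 (Q r) j + + 3 * shift^ 2 (Q r) j - shift^ 3 (Q r) j)
               + (+ 2r+3 r + + 3) * (shift^ 2 (Q r) j - shift^ 3 (Q r) j)

2^[1+m]≡3+[2r+3] : ∀ {m₁} r → 2 ^ m₁ ≡ 3 ℕ.+ r → 2 ^ suc m₁ ≡ 3 ℕ.+ 2r+3 r
2^[1+m]≡3+[2r+3] r h≡ = trans (cong (λ h → h ℕ.+ (h ℕ.+ 0)) h≡) (arith r)
  where
  arith : ∀ r → 3 ℕ.+ r ℕ.+ (3 ℕ.+ r ℕ.+ 0) ≡ 3 ℕ.+ (3 ℕ.+ (r ℕ.+ r))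
  arith = ℕ-solve-∀

pairCount≡Λ : ∀ {m₁ r} {x y : F (suc m₁)} → 2 ^ m₁ ≡ 3 ℕ.+ r →
  x ∈ nonzeroF (suc m₁) → y ∈ nonzeroF (suc m₁) → x ≢ y →
  ∀ j → + (2 ^ suc m₁) * + countPair (suc m₁) (2 ℕ.+ j) x y ≡ Λ r j
pairCount≡Λ {m₁} {r} {x} {y} h≡ x∈ y∈ x≢y j = ℤₚ.*-cancelˡ-≡ (+ 4) _ _ (begin
  + 4 * (N * c)
    ≡⟨ CharacterTerms.pairCount-formula x∈ y∈ x≢y j ⟩
  + 4 * (powSeries (2 ^ suc m₁ ∸ 3) 0 j - V (2 ^ m₁) false false) + N * ∑Bool² (V (2 ^ m₁))
    ≡⟨ cong (λ h → + 4 * (powSeries (2 ^ suc m₁ ∸ 3) 0 j - V h false false) + N * ∑Bool² (V h)) h≡ ⟩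
  + 4 * (powSeries (2 ^ suc m₁ ∸ 3) 0 j - V (3 ℕ.+ r) false false) + N * ∑Bool² (V (3 ℕ.+ r))
    ≡⟨ cong₂ (λ u v → + 4 * (u - v) + N * ∑Bool² (V (3 ℕ.+ r)))
             (trans (powSeries-binomial _ j) (cong (λ n → + (n C j)) n≡)) (characterValue-ff r j) ⟩
  + 4 * (+ (2r+3 r C j) - cube) + N * ∑Bool² (V (3 ℕ.+ r))
    ≡⟨ cong₂ (λ u v → + 4 * (+ (2r+3 r C j) - cube) + u * v) N≡ (characterValue-total r j) ⟩
  + 4 * (+ (2r+3 r C j) - cube) + (+ 2r+3 r + + 3) * (+ 4 * (q₂ - q₃))
    ≡⟨ factor (+ (2r+3 r C j)) cube q₂ q₃ (+ 2r+3 r) ⟩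
  + 4 * Λ r j ∎)
  where
  open ≡-Reasoning
  N = + (2 ^ suc m₁)
  c = + countPair (suc m₁) (2 ℕ.+ j) x y
  V : ℕ → Bool → Bool → ℤ
  V h dx dy = characterValue h dx dy j
  q₂ = shift^ 2 (Q r) j
  q₃ = shift^ 3 (Q r) j
  cube = Q r j - + 3 * shift^ 1 (Q r) j + + 3 * q₂ - q₃
  2^m≡ : 2 ^ suc m₁ ≡ 3 ℕ.+ 2r+3 r
  2^m≡ = 2^[1+m]≡3+[2r+3] {m₁} r h≡
  n≡ : 2 ^ suc m₁ ∸ 3 ≡ 2r+3 r
  n≡ = cong (_∸ 3) 2^m≡
  N≡ : N ≡ + 2r+3 r + + 3
  N≡ = trans (cong +_ 2^m≡) (ℤₚ.+-comm (+ 3) (+ 2r+3 r))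
  factor : ∀ B a q₂ q₃ n → + 4 * (B - a) + (n + + 3) * (+ 4 * (q₂ - q₃)) ≡ + 4 * (B - a + (n + + 3) * (q₂ - q₃))
  factor = solve-∀

pascal : ∀ n k → + (suc n C suc k) ≡ + (n C k) + + (n C suc k)
pascal n k = trans (cong +_ (sym (nCk+nC[k+1]≡[n+1]C[k+1] n k))) (ℤₚ.pos-+ (n C k) (n C suc k))

[k+1]*nC[k+1]≡[n-k]*nCk : ∀ n k → + suc k * + (n C suc k) ≡ (+ n - + k) * + (n C k)
[k+1]*nC[k+1]≡[n-k]*nCk zero    zero    = refl
[k+1]*nC[k+1]≡[n-k]*nCk zero    (suc k) = trans (ℤₚ.*-zeroʳ (+ suc (suc k))) (sym (ℤₚ.*-zeroʳ (+ 0 - + suc k)))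
[k+1]*nC[k+1]≡[n-k]*nCk (suc n) zero    = trans (ℤₚ.*-identityˡ _) (trans (cong +_ (nC1≡n (suc n))) (unit (+ n)))
  where
  unit : ∀ n → + 1 + n ≡ (+ 1 + n - + 0) * + 1
  unit = solve-∀
[k+1]*nC[k+1]≡[n-k]*nCk (suc n) (suc k) = begin
  + suc (suc k) * + (suc n C suc (suc k))
    ≡⟨ cong (+ suc (suc k) *_) (pascal n (suc k)) ⟩
  + suc (suc k) * (+ (n C suc k) + + (n C suc (suc k)))
    ≡⟨ ℤₚ.*-distribˡ-+ (+ suc (suc k)) (+ (n C suc k)) (+ (n C suc (suc k))) ⟩
  + suc (suc k) * + (n C suc k) + + suc (suc k) * + (n C suc (suc k))
    ≡⟨ cong (_+_ (+ suc (suc k) * + (n C suc k))) ([k+1]*nC[k+1]≡[n-k]*nCk n (suc k)) ⟩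
  + suc (suc k) * + (n C suc k) + (+ n - + suc k) * + (n C suc k)
    ≡⟨ regroup (+ k) (+ n) (+ (n C suc k)) ⟩
  + suc k * + (n C suc k) + (+ n - + k) * + (n C suc k)
    ≡⟨ cong (_+ (+ n - + k) * + (n C suc k)) ([k+1]*nC[k+1]≡[n-k]*nCk n k) ⟩
  (+ n - + k) * + (n C k) + (+ n - + k) * + (n C suc k)
    ≡⟨ sym (ℤₚ.*-distribˡ-+ (+ n - + k) (+ (n C k)) (+ (n C suc k))) ⟩
  (+ n - + k) * (+ (n C k) + + (n C suc k))
    ≡⟨ cong₂ _*_ (shift-both (+ n) (+ k)) (sym (pascal n k)) ⟩
  (+ suc n - + suc k) * + (suc n C suc k) ∎
  where
  open ≡-Reasoning
  regroup : ∀ k n b → (+ 1 + (+ 1 + k)) * b + (n - (+ 1 + k)) * b ≡ (+ 1 + k) * b + (n - k) * b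
  regroup = solve-∀
  shift-both : ∀ n k → n - k ≡ + 1 + n - (+ 1 + k)
  shift-both = solve-∀

cosHalfπ : ℕ → ℤ
cosHalfπ zero          = + 1
cosHalfπ (suc zero)    = + 0
cosHalfπ (suc (suc k)) = - cosHalfπ k

Q-closed : ∀ r j → Q r j ≡ cosHalfπ j * + (r C ⌊ j /2⌋)
Q-closed zero    zero          = refl
Q-closed zero    (suc zero)    = refl
Q-closed zero    (suc (suc j)) = sym (ℤₚ.*-zeroʳ (- cosHalfπ j))
Q-closed (suc r) zero          = trans (ℤₚ.+-identityʳ _) (Q-closed r 0)
Q-closed (suc r) (suc zero)    = trans (ℤₚ.+-identityʳ _) (Q-closed r 1)
Q-closed (suc r) (suc (suc j)) = begin
  Q r (suc (suc j)) - Q r j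
    ≡⟨ cong₂ _-_ (Q-closed r (suc (suc j))) (Q-closed r j) ⟩
  - cosHalfπ j * + (r C suc ⌊ j /2⌋) - cosHalfπ j * + (r C ⌊ j /2⌋)
    ≡⟨ collect (cosHalfπ j) (+ (r C suc ⌊ j /2⌋)) (+ (r C ⌊ j /2⌋)) ⟩
  - cosHalfπ j * (+ (r C ⌊ j /2⌋) + + (r C suc ⌊ j /2⌋))
    ≡⟨ cong (- cosHalfπ j *_) (sym (pascal r ⌊ j /2⌋)) ⟩
  - cosHalfπ j * + (suc r C suc ⌊ j /2⌋) ∎
  where
  open ≡-Reasoning
  collect : ∀ s a b → - s * a - s * b ≡ - s * (b + a)
  collect = solve-∀

double : ℕ → ℕ
double zero    = zero
double (suc i) = suc (suc (double i))

data Parity : ℕ → Set where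
  even : ∀ i → Parity (double i)
  odd  : ∀ i → Parity (suc (double i))

parity : ∀ j → Parity j
parity zero    = even 0
parity (suc j) with parity j
... | even i = odd i
... | odd i  = even (suc i)

⌊double/2⌋ : ∀ i → ⌊ double i /2⌋ ≡ i
⌊double/2⌋ zero    = refl
⌊double/2⌋ (suc i) = cong suc (⌊double/2⌋ i)

+double : ∀ i → + double i ≡ + i + + i
+double zero    = refl
+double (suc i) = trans (cong (λ d → + 2 + d) (+double i)) (regroup (+ i))
  where
  regroup : ∀ i → + 2 + (i + i) ≡ + 1 + i + (+ 1 + i)
  regroup = solve-∀

cosHalfπ-odd : ∀ i → cosHalfπ (suc (double i)) ≡ + 0
cosHalfπ-odd zero    = refl
cosHalfπ-odd (suc i) = cong -_ (cosHalfπ-odd i)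

choosePred : ℕ → ℕ → ℕ
choosePred r zero    = 0
choosePred r (suc i) = r C i

Q-even : ∀ r i → Q r (double i) ≡ cosHalfπ (double i) * + (r C i)
Q-even r i = trans (Q-closed r (double i)) (cong (λ k → cosHalfπ (double i) * + (r C k)) (⌊double/2⌋ i))

Q-odd : ∀ r i → Q r (suc (double i)) ≡ + 0
Q-odd r i = trans (Q-closed r (suc (double i))) (cong (_* + (r C ⌊ suc (double i) /2⌋)) (cosHalfπ-odd i))

shift¹Q-even : ∀ r i → shift^ 1 (Q r) (double i) ≡ + 0
shift¹Q-even r zero    = refl
shift¹Q-even r (suc i) = Q-odd r i

shift²Q-even : ∀ r i → shift^ 2 (Q r) (double i) ≡ - cosHalfπ (double i) * + choosePred r i
shift²Q-even r zero    = refl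
shift²Q-even r (suc i) = trans (Q-even r i) (cong (_* + (r C i)) (sym (ℤₚ.neg-involutive (cosHalfπ (double i)))))

shift³Q-even : ∀ r i → shift^ 3 (Q r) (double i) ≡ + 0
shift³Q-even r zero    = refl
shift³Q-even r (suc i) = shift¹Q-even r i

Λ-from : ∀ r j {q₀ q₁ q₂ q₃} → Q r j ≡ q₀ → shift^ 1 (Q r) j ≡ q₁ → shift^ 2 (Q r) j ≡ q₂ → shift^ 3 (Q r) j ≡ q₃ →
  Λ r j ≡ + (2r+3 r C j) - (q₀ - + 3 * q₁ + + 3 * q₂ - q₃) + (+ 2r+3 r + + 3) * (q₂ - q₃)
Λ-from r j refl refl refl refl = refl

Λ-even : ∀ r i → Λ r (double i) ≡ + (2r+3 r C double i) - cosHalfπ (double i) * (+ (r C i) + + 2r+3 r * + choosePred r i)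
Λ-even r i =
  trans (Λ-from r (double i) (Q-even r i) (shift¹Q-even r i) (shift²Q-even r i) (shift³Q-even r i))
        (collect (+ (2r+3 r C double i)) (cosHalfπ (double i)) (+ (r C i)) (+ choosePred r i) (+ 2r+3 r))
  where
  collect : ∀ B s c b n → B - (s * c - + 3 * + 0 + + 3 * (- s * b) - + 0) + (n + + 3) * (- s * b - + 0) ≡ B - s * (c + n * b)
  collect = solve-∀

Λ-odd : ∀ r i → Λ r (suc (double i)) ≡ + (2r+3 r C suc (double i)) + cosHalfπ (double i) * (+ 3 * + (r C i) + (+ 2r+3 r + + 2) * + choosePred r i)
Λ-odd r i =
  trans (Λ-from r (suc (double i)) (Q-odd r i) (Q-even r i) (shift¹Q-even r i) (shift²Q-even r i))
        (collect (+ (2r+3 r C suc (double i))) (cosHalfπ (double i)) (+ (r C i)) (+ choosePred r i) (+ 2r+3 r))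
  where
  collect : ∀ B s c b n → B - (+ 0 - + 3 * (s * c) + + 3 * + 0 - - s * b) + (n + + 3) * (+ 0 - - s * b) ≡ B + s * (+ 3 * c + (n + + 2) * b)
  collect = solve-∀

cancel-hypotheses : ∀ {lhs rhs} k₁ k₂ k₃ {a₁ b₁ a₂ b₂ a₃ b₃} →
  lhs ≡ rhs + k₁ * (a₁ - b₁) + k₂ * (a₂ - b₂) + k₃ * (a₃ - b₃) → a₁ ≡ b₁ → a₂ ≡ b₂ → a₃ ≡ b₃ → lhs ≡ rhs
cancel-hypotheses {rhs = rhs} k₁ k₂ k₃ {b₁ = b₁} {b₂ = b₂} {b₃ = b₃} expansion refl refl refl =
  trans expansion (vanish rhs k₁ k₂ k₃ b₁ b₂ b₃)
  where
  vanish : ∀ r k₁ k₂ k₃ b₁ b₂ b₃ → r + k₁ * (b₁ - b₁) + k₂ * (b₂ - b₂) + k₃ * (b₃ - b₃) ≡ r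
  vanish = solve-∀

recurrence-even-core : ∀ {n D} R I s c b B C₀ C₁ → n ≡ + 3 + (R + R) → D ≡ I + I →
  (+ 1 + D) * C₁ ≡ (n - D) * C₀ → I * c ≡ (R + + 1 - I) * b → B ≡ c + b →
  (+ 1 + D) * (C₁ + s * (+ 3 * c + (n + + 2) * b)) ≡ (n - D) * (C₀ - s * (c + n * b)) + s * (n + + 3) * (+ 1 + D) * B
recurrence-even-core R I s c b B C₀ C₁ refl refl =
  cancel-hypotheses (+ 1) (- s * (+ 4 * R + + 8)) (- s * (+ 3 + (R + R) + + 3) * (+ 1 + (I + I))) (expand R I s c b B C₀ C₁)
  where
  expand : ∀ R I s c b B C₀ C₁ →
    (+ 1 + (I + I)) * (C₁ + s * (+ 3 * c + (+ 3 + (R + R) + + 2) * b))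
      ≡ (+ 3 + (R + R) - (I + I)) * (C₀ - s * (c + (+ 3 + (R + R)) * b)) + s * (+ 3 + (R + R) + + 3) * (+ 1 + (I + I)) * B
        + + 1 * ((+ 1 + (I + I)) * C₁ - (+ 3 + (R + R) - (I + I)) * C₀)
        + - s * (+ 4 * R + + 8) * (I * c - (R + + 1 - I) * b)
        + - s * (+ 3 + (R + R) + + 3) * (+ 1 + (I + I)) * (B - (c + b))
  expand = solve-∀

recurrence-odd-core : ∀ {n D} R I s c b d C₁ C₂ → n ≡ + 3 + (R + R) → D ≡ I + I →
  (+ 1 + (+ 1 + D)) * C₂ ≡ (n - (+ 1 + D)) * C₁ → (+ 1 + I) * d ≡ (R - I) * c → I * c ≡ (R + + 1 - I) * b →
  (+ 1 + (+ 1 + D)) * (C₂ - - s * (d + n * c)) ≡ (n - (+ 1 + D)) * (C₁ + s * (+ 3 * c + (n + + 2) * b))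
recurrence-odd-core R I s c b d C₁ C₂ refl refl =
  cancel-hypotheses (+ 1) (s * + 2) (s * (+ 4 * R + + 10)) (expand R I s c b d C₁ C₂)
  where
  expand : ∀ R I s c b d C₁ C₂ →
    (+ 1 + (+ 1 + (I + I))) * (C₂ - - s * (d + (+ 3 + (R + R)) * c))
      ≡ (+ 3 + (R + R) - (+ 1 + (I + I))) * (C₁ + s * (+ 3 * c + (+ 3 + (R + R) + + 2) * b))
        + + 1 * ((+ 1 + (+ 1 + (I + I))) * C₂ - (+ 3 + (R + R) - (+ 1 + (I + I))) * C₁)
        + s * + 2 * ((+ 1 + I) * d - (R - I) * c)
        + s * (+ 4 * R + + 10) * (I * c - (R + + 1 - I) * b)
  expand = solve-∀

+2r+3 : ∀ r → + 2r+3 r ≡ + 3 + (+ r + + r)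
+2r+3 r = cong (_+_ (+ 3)) (ℤₚ.pos-+ r r)

choosePred-absorb : ∀ r i → + i * + (r C i) ≡ (+ r + + 1 - + i) * + choosePred r i
choosePred-absorb r zero    = sym (ℤₚ.*-zeroʳ (+ r + + 1 - + 0))
choosePred-absorb r (suc i) = trans ([k+1]*nC[k+1]≡[n-k]*nCk r i) (cong (_* + (r C i)) (shift-both (+ r) (+ i)))
  where
  shift-both : ∀ r i → r - i ≡ r + + 1 - (+ 1 + i)
  shift-both = solve-∀

choosePred-pascal : ∀ r i → + (suc r C i) ≡ + (r C i) + + choosePred r i
choosePred-pascal r zero    = refl
choosePred-pascal r (suc i) = trans (pascal r i) (ℤₚ.+-comm (+ (r C i)) (+ (r C suc i)))

Λ-recurrence-even : ∀ r i → + suc (double i) * Λ r (suc (double i))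
  ≡ (+ 2r+3 r - + double i) * Λ r (double i) + cosHalfπ (double i) * (+ 2r+3 r + + 3) * + suc (double i) * + (suc r C i)
Λ-recurrence-even r i = begin
  + suc (double i) * Λ r (suc (double i))
    ≡⟨ cong (+ suc (double i) *_) (Λ-odd r i) ⟩
  + suc (double i) * (C₁ + s * (+ 3 * c + (n + + 2) * b))
    ≡⟨ recurrence-even-core (+ r) (+ i) s c b (+ (suc r C i)) C₀ C₁ (+2r+3 r) (+double i)
         ([k+1]*nC[k+1]≡[n-k]*nCk (2r+3 r) (double i)) (choosePred-absorb r i) (choosePred-pascal r i) ⟩
  (n - + double i) * (C₀ - s * (c + n * b)) + s * (n + + 3) * + suc (double i) * + (suc r C i)
    ≡⟨ cong (λ u → (n - + double i) * u + s * (n + + 3) * + suc (double i) * + (suc r C i)) (sym (Λ-even r i)) ⟩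
  (n - + double i) * Λ r (double i) + s * (n + + 3) * + suc (double i) * + (suc r C i) ∎
  where
  open ≡-Reasoning
  n = + 2r+3 r
  s = cosHalfπ (double i)
  c = + (r C i)
  b = + choosePred r i
  C₀ = + (2r+3 r C double i)
  C₁ = + (2r+3 r C suc (double i))

Λ-recurrence-odd : ∀ r i →
  + suc (suc (double i)) * Λ r (double (suc i)) ≡ (+ 2r+3 r - + suc (double i)) * Λ r (suc (double i))
Λ-recurrence-odd r i = begin
  + suc (suc (double i)) * Λ r (double (suc i))
    ≡⟨ cong (+ suc (suc (double i)) *_) (Λ-even r (suc i)) ⟩
  + suc (suc (double i)) * (C₂ - - s * (d + n * c))
    ≡⟨ recurrence-odd-core (+ r) (+ i) s c b d C₁ C₂ (+2r+3 r) (+double i)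
         ([k+1]*nC[k+1]≡[n-k]*nCk (2r+3 r) (suc (double i))) ([k+1]*nC[k+1]≡[n-k]*nCk r i) (choosePred-absorb r i) ⟩
  (n - + suc (double i)) * (C₁ + s * (+ 3 * c + (n + + 2) * b))
    ≡⟨ cong ((n - + suc (double i)) *_) (sym (Λ-odd r i)) ⟩
  (n - + suc (double i)) * Λ r (suc (double i)) ∎
  where
  open ≡-Reasoning
  n = + 2r+3 r
  s = cosHalfπ (double i)
  c = + (r C i)
  b = + choosePred r i
  d = + (r C suc i)
  C₁ = + (2r+3 r C suc (double i))
  C₂ = + (2r+3 r C suc (suc (double i)))

Λ-recurrence : ∀ r j → + suc j * Λ r (suc j)
  ≡ (+ 2r+3 r - + j) * Λ r j + cosHalfπ j * (+ 2r+3 r + + 3) * + suc j * + (suc r C ⌊ j /2⌋)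
Λ-recurrence r j with parity j
... | even i rewrite ⌊double/2⌋ i = Λ-recurrence-even r i
... | odd i  rewrite cosHalfπ-odd i = trans (Λ-recurrence-odd r i) (sym (ℤₚ.+-identityʳ _))

double≡+ : ∀ i → double i ≡ i ℕ.+ i
double≡+ zero    = refl
double≡+ (suc i) = cong suc (trans (cong suc (double≡+ i)) (sym (ℕₚ.+-suc i i)))

choosePred-diag : ∀ r → + choosePred (suc r) (suc r) ≡ + suc r
choosePred-diag r = begin
  + (suc r C r)                           ≡⟨ unit (+ (suc r C r)) (+ r) ⟩
  (+ suc r - + r) * + (suc r C r)         ≡⟨ [k+1]*nC[k+1]≡[n-k]*nCk (suc r) r ⟨
  + suc r * + (suc r C suc r)             ≡⟨ cong (λ c → + suc r * + c) (nCn≡1 (suc r)) ⟩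
  + suc r * + 1                           ≡⟨ ℤₚ.*-identityʳ (+ suc r) ⟩
  + suc r                                 ∎
  where
  open ≡-Reasoning
  unit : ∀ c r → c ≡ (+ 1 + r - r) * c
  unit = solve-∀

binomial-second-last : ∀ r → + 2 * + (2r+3 r C suc (double r)) ≡ (+ 2r+3 r - + 1) * + 2r+3 r
binomial-second-last r = begin
  + 2 * + (2r+3 r C suc (double r))     ≡⟨ cong (λ k → + 2 * + (2r+3 r C k)) (sym complement) ⟩
  + 2 * + (2r+3 r C (2r+3 r ∸ 2))       ≡⟨ cong (λ c → + 2 * + c) (sym (nCk≡nC[n∸k] {2} {2r+3 r} (s≤s (s≤s z≤n)))) ⟩
  + 2 * + (2r+3 r C 2)                  ≡⟨ [k+1]*nC[k+1]≡[n-k]*nCk (2r+3 r) 1 ⟩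
  (+ 2r+3 r - + 1) * + (2r+3 r C 1)     ≡⟨ cong (λ c → (+ 2r+3 r - + 1) * + c) (nC1≡n (2r+3 r)) ⟩
  (+ 2r+3 r - + 1) * + 2r+3 r           ∎
  where
  open ≡-Reasoning
  complement : 2r+3 r ∸ 2 ≡ suc (double r)
  complement = cong suc (sym (double≡+ r))

Λ-top : ∀ r → cosHalfπ (double r) ≡ -1ℤ → Λ r (suc (double r)) ≡ + 0
Λ-top (suc r) cos≡-1 = ℤₚ.*-cancelˡ-≡ (+ 2) _ _ (begin
  + 2 * Λ R (suc (double R))
    ≡⟨ cong (+ 2 *_) (Λ-odd R R) ⟩
  + 2 * (+ (n C suc (double R)) + cosHalfπ (double R) * (+ 3 * + (R C R) + (+ n + + 2) * + choosePred R R))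
    ≡⟨ cong₂ (λ s b → + 2 * (+ (n C suc (double R)) + s * (+ 3 * + (R C R) + (+ n + + 2) * b))) cos≡-1 (choosePred-diag r) ⟩
  + 2 * (+ (n C suc (double R)) + -1ℤ * (+ 3 * + (R C R) + (+ n + + 2) * + R))
    ≡⟨ cong (λ c → + 2 * (+ (n C suc (double R)) + -1ℤ * (+ 3 * + c + (+ n + + 2) * + R))) (nCn≡1 R) ⟩
  + 2 * (+ (n C suc (double R)) + -1ℤ * (+ 3 * + 1 + (+ n + + 2) * + R))
    ≡⟨ distrib (+ (n C suc (double R))) (+ n) (+ R) ⟩
  + 2 * + (n C suc (double R)) - + 2 * (+ 3 + (+ n + + 2) * + R)
    ≡⟨ cong (_- + 2 * (+ 3 + (+ n + + 2) * + R)) (binomial-second-last R) ⟩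
  (+ n - + 1) * + n - + 2 * (+ 3 + (+ n + + 2) * + R)
    ≡⟨ cong (λ k → (k - + 1) * k - + 2 * (+ 3 + (k + + 2) * + R)) (+2r+3 R) ⟩
  (+ 3 + (+ R + + R) - + 1) * (+ 3 + (+ R + + R)) - + 2 * (+ 3 + (+ 3 + (+ R + + R) + + 2) * + R)
    ≡⟨ vanish (+ R) ⟩
  + 2 * + 0 ∎)
  where
  open ≡-Reasoning
  R = suc r
  n = 2r+3 R
  distrib : ∀ C n R → + 2 * (C + -1ℤ * (+ 3 * + 1 + (n + + 2) * R)) ≡ + 2 * C - + 2 * (+ 3 + (n + + 2) * R)
  distrib = solve-∀
  vanish : ∀ R → (+ 3 + (R + R) - + 1) * (+ 3 + (R + R)) - + 2 * (+ 3 + (+ 3 + (R + R) + + 2) * R) ≡ + 2 * + 0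
  vanish = solve-∀

cosHalfπ-mod4 : ∀ k → cosHalfπ (k % 4) ≡ cosHalfπ k
cosHalfπ-mod4 zero                         = refl
cosHalfπ-mod4 (suc zero)                   = refl
cosHalfπ-mod4 (suc (suc zero))             = refl
cosHalfπ-mod4 (suc (suc (suc zero)))       = refl
cosHalfπ-mod4 (suc (suc (suc (suc k)))) =
  trans (cong cosHalfπ (trans (cong (_% 4) (ℕₚ.+-comm 4 k)) ([m+n]%n≡m%n k 4)))
        (trans (cosHalfπ-mod4 k) (sym (ℤₚ.neg-involutive (cosHalfπ k))))

by-residue-mod4 : ∀ k {L X a : ℤ} → L ≡ X - cosHalfπ k * a →
  ((k % 4 ≡ 1) → L ≡ X) × ((k % 4 ≡ 3) → L ≡ X) × ((k % 4 ≡ 2) → L ≡ X + a) × ((k % 4 ≡ 0) → L ≡ X - a)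
by-residue-mod4 k {L} {X} {a} L≡ =
  (λ k≡1 → trans (at k≡1) (ℤₚ.+-identityʳ X)) ,
  (λ k≡3 → trans (at k≡3) (ℤₚ.+-identityʳ X)) ,
  (λ k≡2 → trans (at k≡2) (flip X a)) ,
  (λ k≡0 → trans (at k≡0) (cong (_-_ X) (ℤₚ.*-identityˡ a)))
  where
  at : ∀ {i} → k % 4 ≡ i → L ≡ X - cosHalfπ i * a
  at refl = trans L≡ (cong (λ c → X - c * a) (sym (cosHalfπ-mod4 k)))
  flip : ∀ X a → X - - + 1 * a ≡ X + a
  flip = solve-∀

cosHalfπ-double² : ∀ t → cosHalfπ (double (double t)) ≡ + 1
cosHalfπ-double² zero    = refl
cosHalfπ-double² (suc t) = trans (ℤₚ.neg-involutive _) (cosHalfπ-double² t)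

binomial-index : ∀ i → (2 ℕ.+ double i) / 2 ∸ 1 ≡ i
binomial-index i = cong (_∸ 1) (trans (cong (_/ 2) (trans (double≡+ (suc i)) (twice (suc i)))) (m*n/n≡m (suc i) 2))
  where
  twice : ∀ n → n ℕ.+ n ≡ n ℕ.* 2
  twice = ℕ-solve-∀

module Recurrence (m₃ : ℕ) where

  M : ℕ
  M = 3 ℕ.+ m₃

  -- r = 2^(M-1) - 3 = 4 (2^m₃ - 1) + 1 is odd, as Λ-top requires.
  r : ℕ
  r = suc (double (double (ℕ.pred (2 ^ m₃))))

  2^[M-1]≡3+r : 2 ^ (2 ℕ.+ m₃) ≡ 3 ℕ.+ r
  2^[M-1]≡3+r = trans (cong (λ t → 2 ℕ.* (2 ℕ.* t)) (sym (ℕₚ.suc-pred (2 ^ m₃) {{ℕₚ.m^n≢0 2 m₃}})))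
                (trans (arith w) (cong (4 ℕ.+_) (sym quadruple)))
    where
    w = ℕ.pred (2 ^ m₃)
    arith : ∀ w → 2 ℕ.* (2 ℕ.* suc w) ≡ 4 ℕ.+ ((w ℕ.+ w) ℕ.+ (w ℕ.+ w))
    arith = ℕ-solve-∀
    quadruple : double (double w) ≡ (w ℕ.+ w) ℕ.+ (w ℕ.+ w)
    quadruple = trans (double≡+ (double w)) (cong₂ ℕ._+_ (double≡+ w) (double≡+ w))

  2^M≡3+[2r+3] : 2 ^ M ≡ 3 ℕ.+ 2r+3 r
  2^M≡3+[2r+3] = 2^[1+m]≡3+[2r+3] {2 ℕ.+ m₃} r 2^[M-1]≡3+r

  cos-r : cosHalfπ (double r) ≡ -1ℤ
  cos-r = cong -_ (cosHalfπ-double² (double (ℕ.pred (2 ^ m₃))))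

  2^M*lam≡Λ : ∀ {x y : F M} → x ∈ nonzeroF M → y ∈ nonzeroF M → x ≢ y → ∀ j → + (2 ^ M) * + lam M (2 ℕ.+ j) x y ≡ Λ r j
  2^M*lam≡Λ {x} {y} x∈ y∈ x≢y j with (2 ℕ.+ j) ≡ᵇ (2 ^ M ∸ 3) in top
  ... | false = pairCount≡Λ 2^[M-1]≡3+r x∈ y∈ x≢y j
  ... | true  = trans (ℤₚ.*-zeroʳ (+ (2 ^ M))) (sym (subst (λ i → Λ r i ≡ + 0) (sym j≡) (Λ-top r cos-r)))
    where
    -- here lam is 0 by convention, and 2 + j = 2^M - 3 = 2r + 3
    j≡ : j ≡ suc (double r)
    j≡ = trans (ℕₚ.suc-injective (ℕₚ.suc-injective (trans (ℕₚ.≡ᵇ⇒≡ _ _ (subst Bool.T (sym top) _))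
                                                           (cong (_∸ 3) 2^M≡3+[2r+3]))))
               (cong suc (sym (double≡+ r)))

  module _ {x y u v : F M} (x∈ : x ∈ nonzeroF M) (y∈ : y ∈ nonzeroF M) (x≢y : x ≢ y)
                          (u∈ : u ∈ nonzeroF M) (v∈ : v ∈ nonzeroF M) (u≢v : u ≢ v) where

    lam-recurrence : ∀ j → + suc j * + lam M (3 ℕ.+ j) u v
      ≡ (+ 2r+3 r - + j) * + lam M (2 ℕ.+ j) x y + cosHalfπ j * + suc j * + (suc r C ⌊ j /2⌋)
    lam-recurrence j = ℤₚ.*-cancelˡ-≡ N _ _ {{ℕₚ.m^n≢0 2 M}} (begin
      N * (+ suc j * λ₁)
        ≡⟨ swap N (+ suc j) λ₁ ⟩
      + suc j * (N * λ₁)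
        ≡⟨ cong (+ suc j *_) (2^M*lam≡Λ u∈ v∈ u≢v (suc j)) ⟩
      + suc j * Λ r (suc j)
        ≡⟨ Λ-recurrence r j ⟩
      (+ 2r+3 r - + j) * Λ r j + c * (+ 2r+3 r + + 3) * + suc j * binom
        ≡⟨ cong₂ (λ p n → (+ 2r+3 r - + j) * p + c * n * + suc j * binom) (sym (2^M*lam≡Λ x∈ y∈ x≢y j)) (sym N≡) ⟩
      (+ 2r+3 r - + j) * (N * λ₀) + c * N * + suc j * binom
        ≡⟨ factor N (+ 2r+3 r - + j) λ₀ c (+ suc j) binom ⟩
      N * ((+ 2r+3 r - + j) * λ₀ + c * + suc j * binom) ∎)
      where
      open ≡-Reasoning
      N = + (2 ^ M)
      λ₀ = + lam M (2 ℕ.+ j) x y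
      λ₁ = + lam M (3 ℕ.+ j) u v
      c = cosHalfπ j
      binom = + (suc r C ⌊ j /2⌋)
      N≡ : N ≡ + 2r+3 r + + 3
      N≡ = trans (cong +_ 2^M≡3+[2r+3]) (ℤₚ.+-comm (+ 3) (+ 2r+3 r))
      swap : ∀ N s l → N * (s * l) ≡ s * (N * l)
      swap = solve-∀
      factor : ∀ N d l c s b → d * (N * l) + c * N * s * b ≡ N * (d * l + c * s * b)
      factor = solve-∀

    binomial-term : ∀ j → cosHalfπ j * + suc j * + (suc r C ⌊ j /2⌋)
      ≡ - cosHalfπ (2 ℕ.+ j) * (+ suc j * + ((2 ^ (M ∸ 1) ∸ 2) C ((2 ℕ.+ j) / 2 ∸ 1)))
    binomial-term j with parity j
    ... | odd i  rewrite cosHalfπ-odd i = refl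
    ... | even i rewrite ⌊double/2⌋ i | binomial-index i =
      trans (cong (λ n → cosHalfπ (double i) * + suc (double i) * + (n C i)) (cong (_∸ 2) (sym 2^[M-1]≡3+r)))
            (regroup (cosHalfπ (double i)) (+ suc (double i)) (+ ((2 ^ (M ∸ 1) ∸ 2) C i)))
      where
      regroup : ∀ c s b → c * s * b ≡ - - c * (s * b)
      regroup = solve-∀

    coefficient : ∀ j → 2 ℕ.+ j ≤ 2 ^ M ∸ 4 → + 2r+3 r - + j ≡ + (2 ^ M ∸ (2 ℕ.+ j) ∸ 1)
    coefficient j bound = begin
      + 2r+3 r - + j              ≡⟨ ℤₚ.m-n≡m⊖n (2r+3 r) j ⟩
      2r+3 r ⊖ j                  ≡⟨ ℤₚ.⊖-≥ j≤n ⟩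
      + (2r+3 r ∸ j)              ≡⟨ cong (λ t → + (t ∸ 1)) (sym (ℕₚ.+-∸-assoc 1 j≤n)) ⟩
      + (suc (2r+3 r) ∸ j ∸ 1)    ≡⟨ cong (λ t → + (t ∸ (2 ℕ.+ j) ∸ 1)) (sym 2^M≡3+[2r+3]) ⟩
      + (2 ^ M ∸ (2 ℕ.+ j) ∸ 1)   ∎
      where
      open ≡-Reasoning
      j≤n : j ℕ.≤ 2r+3 r
      j≤n = ℕₚ.≤-trans (ℕₚ.m≤n+m j 2)
                       (ℕₚ.≤-trans (subst (λ t → 2 ℕ.+ j ℕ.≤ t ∸ 4) 2^M≡3+[2r+3] bound) (ℕₚ.m∸n≤m (2r+3 r) 1))

    lam-recurrence-cos : ∀ j → 2 ℕ.+ j ≤ 2 ^ M ∸ 4 →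
      + (2 ℕ.+ j ∸ 1) * + lam M (suc (2 ℕ.+ j)) u v
        ≡ + (2 ^ M ∸ (2 ℕ.+ j) ∸ 1) * + lam M (2 ℕ.+ j) x y
          - cosHalfπ (2 ℕ.+ j) * (+ (2 ℕ.+ j ∸ 1) * + ((2 ^ (M ∸ 1) ∸ 2) C ((2 ℕ.+ j) / 2 ∸ 1)))
    lam-recurrence-cos j bound =
      trans (lam-recurrence j)
            (cong₂ _+_ (cong (_* + lam M (2 ℕ.+ j) x y) (coefficient j bound))
                       (trans (binomial-term j) (sym (ℤₚ.neg-distribˡ-* (cosHalfπ (2 ℕ.+ j)) _))))

corollary2p11 : (m k : ℕ) → 3 ≤ m → 3 ≤ k → k ≤ 2 ^ m ∸ 4 →
  (x y u v : F m) → x ∈ nonzeroF m → y ∈ nonzeroF m → ¬ (x ≡ y) →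
  u ∈ nonzeroF m → v ∈ nonzeroF m → ¬ (u ≡ v) →
  ((k % 4 ≡ 1) → (+ (k ∸ 1)) * (+ lam m (suc k) u v) ≡ (+ (2 ^ m ∸ k ∸ 1)) * (+ lam m k x y))
  × ((k % 4 ≡ 3) → (+ (k ∸ 1)) * (+ lam m (suc k) u v) ≡ (+ (2 ^ m ∸ k ∸ 1)) * (+ lam m k x y))
  × ((k % 4 ≡ 2) → (+ (k ∸ 1)) * (+ lam m (suc k) u v)
                     ≡ (+ (2 ^ m ∸ k ∸ 1)) * (+ lam m k x y) + (+ (k ∸ 1)) * (+ ((2 ^ (m ∸ 1) ∸ 2) C (k / 2 ∸ 1))))
  × ((k % 4 ≡ 0) → (+ (k ∸ 1)) * (+ lam m (suc k) u v)
                     ≡ (+ (2 ^ m ∸ k ∸ 1)) * (+ lam m k x y) - (+ (k ∸ 1)) * (+ ((2 ^ (m ∸ 1) ∸ 2) C (k / 2 ∸ 1))))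
corollary2p11 _ _ (s≤s (s≤s (s≤s (z≤n {m₃})))) (s≤s (s≤s (s≤s (z≤n {j})))) k≤ x y u v x∈ y∈ x≢y u∈ v∈ u≢v =
  by-residue-mod4 (3 ℕ.+ j) (Recurrence.lam-recurrence-cos m₃ x∈ y∈ x≢y u∈ v∈ u≢v (suc j) k≤)
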